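{- Let $p\equiv1\pmod4$ be prime, let $K=kp$ be odd ($k$ a positive integer), and let $h$ be an integer with $(h,K)=1$ that is a quadratic residue modulo $p$. Then $\tau_{\mathbf{er}}(h,K)\equiv0\pmod2$ if $h$ is a quartic residue modulo $p$, and $\tau_{\mathbf{er}}(h,K)\equiv1\pmod 2$ if $h$ is a quadratic residue but not a quartic residue modulo $p$. Moreover, $\tau_{\mathbf{es}}(h,K)\equiv\tau_{\mathbf{er}}(h,K)\pmod2$.
   Context: $\chi_\mu=\left(\frac{\mu}{p}\right)$ is the Legendre symbol. For an integer $x$, $\{x\}_K$ is the unique integer with $x\equiv\{x\}_K\pmod K$ and $0\le\{x\}_K<K$. Define $\tau_{\mathbf{er}}(h,K)=\#\{0<\mu<K:\ p\nmid\mu,\ \mu\text{ even},\ \chi_\mu=1,\ \{h\mu\}_K\text{ odd}\}$ and $\tau_{\mathbf{es}}(h,K)=\#\{0<\mu<K:\ p\nmid\mu,\ \mu\text{ even},\ \chi_\mu=-1,\ \{h\mu\}_K\text{ odd}\}$. -}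

module Defs where

open import Data.Nat as ℕ using (ℕ; zero; suc; _<_; _<?_; _≟_)
open import Data.Nat.Divisibility as ℕD using (_∣?_)
open import Data.Integer as ℤ using (ℤ; +_; _%ℕ_)
import Data.Integer.Divisibility as ℤD
open import Data.Product using (∃)
open import Data.List using (List; upTo; filter; length)
open import Data.List.Relation.Unary.Any using (Any; any?)
open import Data.Product using (_×_)
open import Relation.Nullary using (¬_; Dec; yes; no; ¬?)
open import Relation.Nullary.Decidable using (_×-dec_)
open import Relation.Binary.PropositionalEquality using (_≡_)

-- {x}_K : least nonnegative residue of the integer x modulo K.
-- (The case K = 0 never arises under the hypotheses; it is set to 0.)
residue : ℤ → ℕ → ℕ
residue x zero    = 0
residue x (suc n) = x %ℕ suc n

IsSquareMod : ℕ → ℕ → Set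
IsSquareMod p μ = Any (λ x → residue (+ (x ℕ.* x)) p ≡ residue (+ μ) p) (upTo p)

isSquareMod? : ∀ p μ → Dec (IsSquareMod p μ)
isSquareMod? p μ = any? (λ x → residue (+ (x ℕ.* x)) p ≟ residue (+ μ) p) (upTo p)

legendre : ℕ → ℕ → ℤ
legendre p μ with p ∣? μ
... | yes _ = + 0
... | no _ with isSquareMod? p μ
...   | yes _ = + 1
...   | no _  = ℤ.- (+ 1)

-- The conditions defining τ_er (s = +1) and τ_es (s = -1):
-- 0 < μ, p ∤ μ, μ even, χ_μ = s, {hμ}_K odd.
TauCond : (s h : ℤ) (p K : ℕ) → ℕ → Set
TauCond s h p K μ = 0 < μ × ¬ (p ℕD.∣ μ) × (2 ℕD.∣ μ) × legendre p μ ≡ s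
                    × ¬ (2 ℕD.∣ residue (h ℤ.* + μ) K)

tauCond? : ∀ s h p K μ → Dec (TauCond s h p K μ)
tauCond? s h p K μ = (0 <? μ) ×-dec ¬? (p ∣? μ) ×-dec (2 ∣? μ)
  ×-dec (legendre p μ ℤ.≟ s) ×-dec ¬? (2 ∣? residue (h ℤ.* + μ) K)

τer : ℤ → ℕ → ℕ → ℕ
τer h p K = length (filter (tauCond? (+ 1) h p K) (upTo K))

τes : ℤ → ℕ → ℕ → ℕ
τes h p K = length (filter (tauCond? (ℤ.- (+ 1)) h p K) (upTo K))

QuadraticResidue : ℤ → ℕ → Set
QuadraticResidue h p = ∃ λ (x : ℤ) → (+ p) ℤD.∣ (x ℤ.* x ℤ.- h)

QuarticResidue : ℤ → ℕ → Set
QuarticResidue h p = ∃ λ (x : ℤ) → (+ p) ℤD.∣ (x ℤ.* x ℤ.* x ℤ.* x ℤ.- h)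

-- Write p = 4q + 1 and K = kp. For s = ±1 let E_s be the even μ ∈ (0, K) prime to p with χ_μ = s,
-- so that τ_er and τ_es count the μ ∈ E_s with {hμ}_K odd. As K is odd, sending μ to whichever of
-- {hμ}_K and K − {hμ}_K is even permutes E_s (χ is preserved because h and −1 are squares modulo p),
-- and comparing ∏ E_s with the product of its image gives (−1)^τ h^|E_s| ≡ 1 (mod p), as in Gauss'
-- lemma. Among the 2qk numbers μ < K with χ_μ = s the reflection μ ↦ K − μ exchanges the even and
-- the odd ones, so |E_s| = qk; as k is odd and h^(2q) ≡ 1, this gives (−1)^τ ≡ h^q. Finally, for
-- h ≡ x², Euler's criterion shows that h^q ≡ x^(2q) is 1 or −1 according as x is a square, that
-- is, as h is a quartic residue.
module Submission where

open import Defs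
open import Data.Nat as ℕ using (ℕ; zero; suc; z≤n; s≤s)
import Data.Nat.Properties as ℕₚ
open import Data.Nat.Divisibility
  using (_∣_; _∣?_; _∣0; ∣-refl; n∣m*n; ∣⇒≤; ∣1⇒≡1; ∣m∸n∣n⇒∣m; m%n≡0⇒n∣m)
open import Data.Nat.DivMod using (m%n<n; %-distribˡ-+)
open import Data.Nat.Primality using (Prime; euclidsLemma; ¬prime[1])
open import Data.Nat.Coprimality using (Coprime)
open import Data.Integer as ℤ using (ℤ; +_; 0ℤ; 1ℤ; -1ℤ)
import Data.Integer.Properties as ℤₚ
open import Data.List using (List; []; _∷_; _++_; map; foldr; length; filter; upTo; applyUpTo)
open import Data.List.Properties
  using (length-++; length-map; length-applyUpTo; map-∘; ++-identityʳ; map-upTo; filter-++; filter-all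
        ; filter-accept; filter-reject; filter-≐)
open import Data.List.Membership.Propositional using (_∈_; lose)
open import Data.List.Membership.Propositional.Properties
  using (∈-∃++; ∈-++⁻; ∈-++⁺ˡ; ∈-++⁺ʳ; ∈-map⁺; ∈-map⁻; ∈-filter⁺; ∈-filter⁻; ∈-applyUpTo⁺; ∈-applyUpTo⁻
        ; ∈-upTo⁺; ∈-upTo⁻)
open import Data.List.Relation.Unary.Any as Any using (here; there)
open import Data.List.Relation.Unary.All as All using ([]; _∷_)
import Data.List.Relation.Unary.All.Properties as Allₚ
open import Data.List.Relation.Unary.AllPairs using ([]; _∷_)
open import Data.List.Relation.Unary.Unique.Propositional using (Unique)
import Data.List.Relation.Unary.Unique.Propositional.Properties as Unique
open import Data.List.Relation.Binary.Subset.Propositional using (_⊆_)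
open import Data.List.Relation.Binary.Permutation.Propositional
  using (_↭_; prep; ↭-refl; ↭-sym; ↭-trans; ↭⇒↭ₛ)
import Data.List.Relation.Binary.Permutation.Propositional.Properties as ↭
open ↭ using (shift; ↭-length)
open import Data.List.Relation.Binary.Permutation.Setoid.Properties using (foldr-commMonoid)
open import Data.Empty using (⊥)
open import Data.Product as Product using (_×_; _,_; proj₁; proj₂; ∃)
open import Data.Sum as Sum using (_⊎_; inj₁; inj₂; [_,_]′)
open import Function using (id; flip; _∘_; _⇔_; Equivalence; mk⇔)
open import Level using (0ℓ)
open import Relation.Nullary using (¬_; ¬?; yes; no; contradiction)
open import Relation.Nullary.Decidable using (map′; decidable-stable; toSum; _⊎-dec_; _×-dec_)
open import Relation.Unary using (Pred; Decidable; ∅; _∪_; _∩_; _≐_) renaming (_⊆_ to _⊆ᵤ_)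
open import Relation.Unary.Properties using (_∩?_; ∁?)
open import Relation.Binary.PropositionalEquality

private
  variable
    A B : Set
    xs ys : List A

-- Duplicate-free lists

InjectiveOn : (A → B) → List A → Set
InjectiveOn f xs = ∀ {x y} → x ∈ xs → y ∈ xs → f x ≡ f y → x ≡ y

unique-⊆⇒↭++ : Unique xs → xs ⊆ ys → ∃ λ zs → ys ↭ xs ++ zs
unique-⊆⇒↭++ {xs = []} {ys} _ _ = ys , ↭-refl
unique-⊆⇒↭++ {xs = x ∷ xs} (x∉xs ∷ xs!) x∷xs⊆ys with as , bs , refl ← ∈-∃++ (x∷xs⊆ys (here refl)) =
  let zs , as++bs↭xs++zs = unique-⊆⇒↭++ xs! xs⊆as++bs
  in zs , ↭-trans (shift x as bs) (prep x as++bs↭xs++zs)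
  where
  xs⊆as++bs : xs ⊆ as ++ bs
  xs⊆as++bs y∈xs with ∈-++⁻ as (x∷xs⊆ys (there y∈xs))
  ... | inj₁ y∈as         = ∈-++⁺ˡ y∈as
  ... | inj₂ (here refl)  = contradiction refl (All.lookup x∉xs y∈xs)
  ... | inj₂ (there y∈bs) = ∈-++⁺ʳ as y∈bs

unique-⊆⇒length≤ : Unique xs → xs ⊆ ys → length xs ℕ.≤ length ys
unique-⊆⇒length≤ {xs = xs} xs! xs⊆ys =
  let zs , ys↭xs++zs = unique-⊆⇒↭++ xs! xs⊆ys in begin
  length xs               ≤⟨ ℕₚ.m≤m+n (length xs) (length zs) ⟩
  length xs ℕ.+ length zs ≡⟨ length-++ xs ⟨
  length (xs ++ zs)       ≡⟨ ↭-length ys↭xs++zs ⟨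
  _                       ∎
  where open ℕₚ.≤-Reasoning

unique-⊆-length≥⇒↭ : Unique xs → xs ⊆ ys → length ys ℕ.≤ length xs → xs ↭ ys
unique-⊆-length≥⇒↭ {xs = xs} xs! xs⊆ys |ys|≤|xs| with unique-⊆⇒↭++ xs! xs⊆ys
... | [] , ys↭xs++[] = ↭-sym (subst (_ ↭_) (++-identityʳ xs) ys↭xs++[])
... | z ∷ zs , ys↭xs++z∷zs = contradiction |ys|≤|xs| (ℕₚ.<⇒≱ (begin-strict
  length xs                      <⟨ ℕₚ.m<m+n (length xs) (s≤s z≤n) ⟩
  length xs ℕ.+ length (z ∷ zs)  ≡⟨ length-++ xs ⟨
  length (xs ++ z ∷ zs)          ≡⟨ ↭-length ys↭xs++z∷zs ⟨
  _                              ∎))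
  where open ℕₚ.≤-Reasoning

map-unique : ∀ {f : A → B} → InjectiveOn f xs → Unique xs → Unique (map f xs)
map-unique {xs = []} _ [] = []
map-unique {xs = x ∷ xs} {f} f-inj (x∉xs ∷ xs!) =
  Allₚ.map⁺ (All.tabulate fx∉) ∷ map-unique (λ y∈ z∈ → f-inj (there y∈) (there z∈)) xs!
  where
  fx∉ : ∀ {y} → y ∈ xs → f x ≢ f y
  fx∉ y∈xs fx≡fy = All.lookup x∉xs y∈xs (f-inj (here refl) (there y∈xs) fx≡fy)

map-⊆ : ∀ {f : A → B} → (∀ {x} → x ∈ xs → f x ∈ ys) → map f xs ⊆ ys
map-⊆ {f = f} f∈ fx∈ with _ , x∈ , refl ← ∈-map⁻ f fx∈ = f∈ x∈

injectiveOn⇒length≤ : ∀ {f : A → B} → Unique xs → (∀ {x} → x ∈ xs → f x ∈ ys) → InjectiveOn f xs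
                    → length xs ℕ.≤ length ys
injectiveOn⇒length≤ {xs = xs} {f = f} xs! f∈ f-inj = subst (ℕ._≤ _) (length-map f xs)
  (unique-⊆⇒length≤ (map-unique f-inj xs!) (map-⊆ f∈))

injectiveOn⇒map↭ : ∀ {f : A → A} → Unique xs → (∀ {x} → x ∈ xs → f x ∈ xs) → InjectiveOn f xs
                 → map f xs ↭ xs
injectiveOn⇒map↭ {xs = xs} {f = f} xs! f∈ f-inj =
  unique-⊆-length≥⇒↭ (map-unique f-inj xs!) (map-⊆ f∈) (ℕₚ.≤-reflexive (sym (length-map f xs)))

-- Counting with filters

count : {P : Pred A 0ℓ} → Decidable P → List A → ℕ
count P? xs = length (filter P? xs)

module _ {P : Pred A 0ℓ} (P? : Decidable P) where

  count-++ : ∀ xs {ys} → count P? (xs ++ ys) ≡ count P? xs ℕ.+ count P? ys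
  count-++ xs {ys} = trans (cong length (filter-++ P? xs ys)) (length-++ (filter P? xs))

  filter-++-filter-∁-↭ : ∀ xs → xs ↭ filter P? xs ++ filter (∁? P?) xs
  filter-++-filter-∁-↭ [] = ↭-refl
  filter-++-filter-∁-↭ (x ∷ xs) with P? x
  ... | yes _ = prep x (filter-++-filter-∁-↭ xs)
  ... | no  _ = ↭-trans (prep x (filter-++-filter-∁-↭ xs))
                        (↭-sym (shift x (filter P? xs) (filter (∁? P?) xs)))

  length≡count+count-∁ : ∀ xs → length xs ≡ count P? xs ℕ.+ count (∁? P?) xs
  length≡count+count-∁ xs = trans (↭-length (filter-++-filter-∁-↭ xs)) (length-++ (filter P? xs))

module _ {P Q : Pred A 0ℓ} (P? : Decidable P) (Q? : Decidable Q) where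

  count-≐ : P ≐ Q → ∀ xs → count P? xs ≡ count Q? xs
  count-≐ P≐Q xs = cong length (filter-≐ P? Q? P≐Q xs)

  count-filter : ∀ xs → count Q? (filter P? xs) ≡ count (P? ∩? Q?) xs
  count-filter [] = refl
  count-filter (x ∷ xs) with P? x
  ... | no  _ = count-filter xs
  ... | yes _ with Q? x
  ...   | yes _ = cong suc (count-filter xs)
  ...   | no  _ = count-filter xs

module _ {P Q R : Pred A 0ℓ} (P? : Decidable P) (Q? : Decidable Q) (R? : Decidable R) where

  count-⊎ : P ⊆ᵤ Q ∪ R → Q ∪ R ⊆ᵤ P → Q ∩ R ⊆ᵤ ∅ → ∀ xs → count P? xs ≡ count Q? xs ℕ.+ count R? xs
  count-⊎ P⊆Q∪R Q∪R⊆P disjoint [] = refl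
  count-⊎ P⊆Q∪R Q∪R⊆P disjoint (x ∷ xs) with ih ← count-⊎ P⊆Q∪R Q∪R⊆P disjoint xs | P? x | Q? x | R? x
  ... | yes _  | yes q | yes r = contradiction (q , r) disjoint
  ... | yes _  | yes _ | no  _ = cong suc ih
  ... | yes _  | no  _ | yes _ = trans (cong suc ih) (sym (ℕₚ.+-suc _ _))
  ... | yes px | no ¬q | no ¬r = contradiction (P⊆Q∪R px) [ ¬q , ¬r ]′
  ... | no ¬p  | yes q | _     = contradiction (Q∪R⊆P (inj₁ q)) ¬p
  ... | no ¬p  | no _  | yes r = contradiction (Q∪R⊆P (inj₂ r)) ¬p
  ... | no _   | no _  | no _  = ih

count-map : ∀ {P : Pred B 0ℓ} (P? : Decidable P) (f : A → B) xs → count P? (map f xs) ≡ count (P? ∘ f) xs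
count-map P? f [] = refl
count-map P? f (x ∷ xs) with P? (f x)
... | yes _ = cong suc (count-map P? f xs)
... | no  _ = count-map P? f xs

applyUpTo-+ : ∀ (f : ℕ → A) m n → applyUpTo f (m ℕ.+ n) ≡ applyUpTo f m ++ applyUpTo (f ∘ (m ℕ.+_)) n
applyUpTo-+ f zero    n = refl
applyUpTo-+ f (suc m) n = cong (f 0 ∷_) (applyUpTo-+ (f ∘ suc) m n)

module _ {P : Pred ℕ 0ℓ} (P? : Decidable P) {d : ℕ} (periodic : P ∘ (d ℕ.+_) ≐ P) where

  count-upTo-periodic : ∀ j → count P? (upTo (j ℕ.* d)) ≡ j ℕ.* count P? (upTo d)
  count-upTo-periodic zero    = refl
  count-upTo-periodic (suc j) = begin
    count P? (upTo (d ℕ.+ j ℕ.* d))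
      ≡⟨ cong (count P?) (applyUpTo-+ id d (j ℕ.* d)) ⟩
    count P? (upTo d ++ applyUpTo (d ℕ.+_) (j ℕ.* d))
      ≡⟨ count-++ P? (upTo d) ⟩
    count P? (upTo d) ℕ.+ count P? (applyUpTo (d ℕ.+_) (j ℕ.* d))
      ≡⟨ cong (count P? (upTo d) ℕ.+_) shifted ⟩
    count P? (upTo d) ℕ.+ j ℕ.* count P? (upTo d) ∎
    where
    open ≡-Reasoning
    shifted : count P? (applyUpTo (d ℕ.+_) (j ℕ.* d)) ≡ j ℕ.* count P? (upTo d)
    shifted = begin
      count P? (applyUpTo (d ℕ.+_) (j ℕ.* d))   ≡⟨ cong (count P?) (map-upTo (d ℕ.+_) (j ℕ.* d)) ⟨
      count P? (map (d ℕ.+_) (upTo (j ℕ.* d)))  ≡⟨ count-map P? (d ℕ.+_) (upTo (j ℕ.* d)) ⟩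
      count (P? ∘ (d ℕ.+_)) (upTo (j ℕ.* d))    ≡⟨ count-≐ (P? ∘ (d ℕ.+_)) P? periodic (upTo (j ℕ.* d)) ⟩
      count P? (upTo (j ℕ.* d))                 ≡⟨ count-upTo-periodic j ⟩
      j ℕ.* count P? (upTo d)                   ∎

-- Fixed-point-free involutions

record FixedPointFreeInvolution (σ : A → A) (xs : List A) : Set where
  field
    σ-closed         : ∀ {x} → x ∈ xs → σ x ∈ xs
    σ-involutive     : ∀ {x} → x ∈ xs → σ (σ x) ≡ x
    fixed-point-free : ∀ {x} → x ∈ xs → σ x ≢ x

  σ-injective : InjectiveOn σ xs
  σ-injective x∈ y∈ σx≡σy = trans (sym (σ-involutive x∈)) (trans (cong σ σx≡σy) (σ-involutive y∈))

module _ {σ : ℕ → ℕ} {xs : List ℕ} (involution : FixedPointFreeInvolution σ xs) where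

  open FixedPointFreeInvolution involution

  -- each orbit {x, σ x} has its smaller element in lower-half and its larger one in upper-half
  lower-half? : Decidable (λ x → x ℕ.< σ x)
  lower-half? x = x ℕ.<? σ x

  lower-half upper-half : List ℕ
  lower-half = filter lower-half? xs
  upper-half = filter (∁? lower-half?) xs

  σ-lower⊆upper : ∀ {x} → x ∈ lower-half → σ x ∈ upper-half
  σ-lower⊆upper {x} x∈lower with x∈xs , x<σx ← ∈-filter⁻ lower-half? x∈lower =
    ∈-filter⁺ (∁? lower-half?) (σ-closed x∈xs)
      (λ σx<σσx → ℕₚ.<-asym x<σx (subst (σ x ℕ.<_) (σ-involutive x∈xs) σx<σσx))

  σ-upper⊆lower : ∀ {x} → x ∈ upper-half → σ x ∈ lower-half
  σ-upper⊆lower x∈upper with x∈xs , x≮σx ← ∈-filter⁻ (∁? lower-half?) x∈upper =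
    ∈-filter⁺ lower-half? (σ-closed x∈xs)
      (subst (σ _ ℕ.<_) (sym (σ-involutive x∈xs)) (ℕₚ.≤∧≢⇒< (ℕₚ.≮⇒≥ x≮σx) (fixed-point-free x∈xs)))

  module _ (xs! : Unique xs) where

    σ-lower-half↭upper-half : map σ lower-half ↭ upper-half
    σ-lower-half↭upper-half =
      unique-⊆-length≥⇒↭ (map-unique (σ-injectiveOn lower-half?) (Unique.filter⁺ lower-half? xs!))
        (map-⊆ σ-lower⊆upper) (begin
          length upper-half          ≤⟨ injectiveOn⇒length≤ (Unique.filter⁺ (∁? lower-half?) xs!)
                                          σ-upper⊆lower (σ-injectiveOn (∁? lower-half?)) ⟩
          length lower-half          ≡⟨ length-map σ lower-half ⟨
          length (map σ lower-half)  ∎)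
      where
      open ℕₚ.≤-Reasoning
      σ-injectiveOn : ∀ {P : Pred ℕ 0ℓ} (P? : Decidable P) → InjectiveOn σ (filter P? xs)
      σ-injectiveOn P? x∈ y∈ = σ-injective (proj₁ (∈-filter⁻ P? x∈)) (proj₁ (∈-filter⁻ P? y∈))

    length≡2*length-lower-half : length xs ≡ length lower-half ℕ.+ length lower-half
    length≡2*length-lower-half = begin
      length xs                                        ≡⟨ length≡count+count-∁ lower-half? xs ⟩
      length lower-half ℕ.+ length upper-half          ≡⟨ cong (length lower-half ℕ.+_) |upper|≡|lower| ⟩
      length lower-half ℕ.+ length lower-half          ∎
      where
      open ≡-Reasoning
      |upper|≡|lower| : length upper-half ≡ length lower-half
      |upper|≡|lower| = trans (sym (↭-length σ-lower-half↭upper-half)) (length-map σ lower-half)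

+-self-injective : ∀ {j k} → j ℕ.+ j ≡ k ℕ.+ k → j ≡ k
+-self-injective {j} {k} j+j≡k+k = ℕₚ.*-cancelˡ-≡ j k 2
  (trans (cong (j ℕ.+_) (ℕₚ.+-identityʳ j)) (trans j+j≡k+k (cong (k ℕ.+_) (sym (ℕₚ.+-identityʳ k)))))

odd⇒%2≡1 : ∀ {a} → ¬ 2 ∣ a → a ℕ.% 2 ≡ 1
odd⇒%2≡1 {a} 2∤a with a ℕ.% 2 | m%n<n a 2 | m%n≡0⇒n∣m a 2
... | zero        | _             | 2∣a = contradiction (2∣a refl) 2∤a
... | suc zero    | _             | _   = refl
... | suc (suc _) | s≤s (s≤s ()) | _

odd+odd⇒even : ∀ {a b} → ¬ 2 ∣ a → ¬ 2 ∣ b → 2 ∣ a ℕ.+ b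
odd+odd⇒even {a} {b} 2∤a 2∤b = m%n≡0⇒n∣m (a ℕ.+ b) 2
  (trans (%-distribˡ-+ a b 2) (cong₂ (λ x y → (x ℕ.+ y) ℕ.% 2) (odd⇒%2≡1 2∤a) (odd⇒%2≡1 2∤b)))

odd∸odd⇒even : ∀ {a b} → ¬ 2 ∣ a → ¬ 2 ∣ b → b ℕ.≤ a → 2 ∣ a ℕ.∸ b
odd∸odd⇒even {a} {b} 2∤a 2∤b b≤a with 2 ∣? (a ℕ.∸ b)
... | yes 2∣a-b = 2∣a-b
... | no  2∤a-b = contradiction (subst (2 ∣_) (ℕₚ.m∸n+n≡m b≤a) (odd+odd⇒even 2∤a-b 2∤b)) 2∤a

odd∸even⇒odd : ∀ {a b} → ¬ 2 ∣ a → 2 ∣ b → b ℕ.≤ a → ¬ 2 ∣ a ℕ.∸ b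
odd∸even⇒odd 2∤a 2∣b b≤a 2∣a-b = 2∤a (∣m∸n∣n⇒∣m 2 b≤a 2∣a-b 2∣b)

module _ {p : ℕ} where

  legendre≢0⇒∤ : ∀ {μ} → legendre p μ ≢ 0ℤ → ¬ p ∣ μ
  legendre≢0⇒∤ {μ} legendre≢0 p∣μ with p ∣? μ
  ... | yes _  = legendre≢0 refl
  ... | no p∤μ = p∤μ p∣μ

  legendre-cong : ∀ {μ ν} → (p ∣ μ ⇔ p ∣ ν) → (IsSquareMod p μ ⇔ IsSquareMod p ν)
                → legendre p μ ≡ legendre p ν
  legendre-cong {μ} {ν} ∣⇔∣ square⇔square with p ∣? μ | p ∣? ν
  ... | yes _   | yes _   = refl
  ... | yes p∣μ | no  p∤ν = contradiction (Equivalence.to ∣⇔∣ p∣μ) p∤ν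
  ... | no  p∤μ | yes p∣ν = contradiction (Equivalence.from ∣⇔∣ p∣ν) p∤μ
  ... | no  _   | no  _   with isSquareMod? p μ | isSquareMod? p ν
  ...   | yes _  | yes _  = refl
  ...   | yes μ□ | no ν̸□ = contradiction (Equivalence.to square⇔square μ□) ν̸□
  ...   | no μ̸□ | yes ν□ = contradiction (Equivalence.from square⇔square ν□) μ̸□
  ...   | no _   | no _   = refl

module Congruence where

  open import Data.Integer using (_+_; _*_; _-_; -_; _^_; ∣_∣; _%ℕ_; _/ℕ_)
  open import Data.Integer.DivMod using (a≡a%ℕn+[a/ℕn]*n)
  open import Data.Integer.Divisibility using () renaming (_∣_ to _∣ᵤ_)
  open import Data.Integer.Divisibility.Signed as Signed
    using (divides; ∣m∣n⇒∣m+n; ∣m⇒∣-m; ∣n⇒∣m*n; ∣m⇒∣m*n; ∣-trans; ∣⇒∣ᵤ; ∣ᵤ⇒∣)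
  import Data.Integer.Coprimality as ℤ
  open import Data.Integer.Tactic.RingSolver using (solve-∀)
  open import Data.Nat.Coprimality using (Coprime)
  open import Relation.Binary.Bundles using (Setoid)
  import Relation.Binary.Reasoning.Setoid as SetoidReasoning

  infix 4 _≡_mod_
  record _≡_mod_ (a b : ℤ) (m : ℕ) : Set where
    constructor congruent
    field m∣a-b : + m Signed.∣ a - b

  module _ {m : ℕ} where

    ≡⇒≡-mod : ∀ {a b} → a ≡ b → a ≡ b mod m
    ≡⇒≡-mod {a} refl = congruent (divides 0ℤ (ℤₚ.+-inverseʳ a))

    ≡-mod-refl : ∀ {a} → a ≡ a mod m
    ≡-mod-refl = ≡⇒≡-mod refl

    ≡-mod-sym : ∀ {a b} → a ≡ b mod m → b ≡ a mod m
    ≡-mod-sym {a} {b} (congruent m∣a-b) =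
      congruent (subst (_ Signed.∣_) (neg-difference a b) (∣m⇒∣-m m∣a-b))
      where
      neg-difference : ∀ a b → - (a - b) ≡ b - a
      neg-difference = solve-∀

    ≡-mod-trans : ∀ {a b c} → a ≡ b mod m → b ≡ c mod m → a ≡ c mod m
    ≡-mod-trans {a} {b} {c} (congruent m∣a-b) (congruent m∣b-c) =
      congruent (subst (_ Signed.∣_) (telescope a b c) (∣m∣n⇒∣m+n m∣a-b m∣b-c))
      where
      telescope : ∀ a b c → (a - b) + (b - c) ≡ a - c
      telescope = solve-∀

    +-cong : ∀ {a b c d} → a ≡ b mod m → c ≡ d mod m → a + c ≡ b + d mod m
    +-cong {a} {b} {c} {d} (congruent m∣a-b) (congruent m∣c-d) =
      congruent (subst (_ Signed.∣_) (sum-difference a b c d) (∣m∣n⇒∣m+n m∣a-b m∣c-d))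
      where
      sum-difference : ∀ a b c d → (a - b) + (c - d) ≡ (a + c) - (b + d)
      sum-difference = solve-∀

    -‿cong : ∀ {a b} → a ≡ b mod m → - a ≡ - b mod m
    -‿cong {a} {b} (congruent m∣a-b) =
      congruent (subst (_ Signed.∣_) (neg-difference a b) (∣m⇒∣-m m∣a-b))
      where
      neg-difference : ∀ a b → - (a - b) ≡ - a - - b
      neg-difference = solve-∀

    *-cong : ∀ {a b c d} → a ≡ b mod m → c ≡ d mod m → a * c ≡ b * d mod m
    *-cong {a} {b} {c} {d} (congruent m∣a-b) (congruent m∣c-d) =
      congruent (subst (_ Signed.∣_) (product-difference a b c d)
                  (∣m∣n⇒∣m+n (∣m⇒∣m*n c m∣a-b) (∣n⇒∣m*n b m∣c-d)))
      where
      product-difference : ∀ a b c d → (a - b) * c + b * (c - d) ≡ a * c - b * d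
      product-difference = solve-∀

    *-congˡ : ∀ c {a b} → a ≡ b mod m → c * a ≡ c * b mod m
    *-congˡ c = *-cong (≡-mod-refl {c})

    *-congʳ : ∀ c {a b} → a ≡ b mod m → a * c ≡ b * c mod m
    *-congʳ c a≡b = *-cong a≡b ≡-mod-refl

    ^-cong : ∀ n {a b} → a ≡ b mod m → a ^ n ≡ b ^ n mod m
    ^-cong zero    a≡b = ≡-mod-refl
    ^-cong (suc n) a≡b = *-cong a≡b (^-cong n a≡b)

  ∣ᵤ⇒≡-mod : ∀ {m a b} → + m ∣ᵤ a - b → a ≡ b mod m
  ∣ᵤ⇒≡-mod = congruent ∘ ∣ᵤ⇒∣

  ≡-mod⇒∣ᵤ : ∀ {m a b} → a ≡ b mod m → + m ∣ᵤ a - b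
  ≡-mod⇒∣ᵤ = ∣⇒∣ᵤ ∘ _≡_mod_.m∣a-b

  ≡-mod-setoid : ℕ → Setoid 0ℓ 0ℓ
  ≡-mod-setoid m = record
    { Carrier       = ℤ
    ; _≈_           = _≡_mod m
    ; isEquivalence = record { refl = ≡-mod-refl ; sym = ≡-mod-sym ; trans = ≡-mod-trans }
    }

  module ≡-mod-Reasoning (m : ℕ) = SetoidReasoning (≡-mod-setoid m)

  module _ {m : ℕ} where

    ≡-mod⇒-≡0 : ∀ {a b} → a ≡ b mod m → a - b ≡ 0ℤ mod m
    ≡-mod⇒-≡0 {a} {b} a≡b = ≡-mod-trans (+-cong a≡b (≡-mod-refl {a = - b})) (≡⇒≡-mod (ℤₚ.+-inverseʳ b))

    -≡0⇒≡-mod : ∀ {a b} → a - b ≡ 0ℤ mod m → a ≡ b mod m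
    -≡0⇒≡-mod {a} {b} a-b≡0 = begin
      a             ≡⟨ cancel a b ⟩
      (a - b) + b   ≈⟨ +-cong a-b≡0 ≡-mod-refl ⟩
      0ℤ + b        ≡⟨ ℤₚ.+-identityˡ b ⟩
      b             ∎
      where
      open ≡-mod-Reasoning m
      cancel : ∀ a b → a ≡ (a - b) + b
      cancel = solve-∀

    ≡0-mod⇒∣ : ∀ {a} → a ≡ 0ℤ mod m → m ∣ ∣ a ∣
    ≡0-mod⇒∣ {a} (congruent m∣a-0) = subst (λ x → m ∣ ∣ x ∣) (ℤₚ.+-identityʳ a) (∣⇒∣ᵤ m∣a-0)

    ∣⇒≡0-mod : ∀ {a} → m ∣ ∣ a ∣ → a ≡ 0ℤ mod m
    ∣⇒≡0-mod {a} m∣a = congruent (∣ᵤ⇒∣ (subst (λ x → m ∣ ∣ x ∣) (sym (ℤₚ.+-identityʳ a)) m∣a))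

    %ℕ-≡-mod : ∀ a .{{_ : ℕ.NonZero m}} → + (a %ℕ m) ≡ a mod m
    %ℕ-≡-mod a = ≡-mod-sym (congruent (divides (a /ℕ m) (begin
      a - + (a %ℕ m)                          ≡⟨ cong (_- + (a %ℕ m)) (a≡a%ℕn+[a/ℕn]*n a m) ⟩
      + (a %ℕ m) + (a /ℕ m) * + m - + (a %ℕ m) ≡⟨ cancel (+ (a %ℕ m)) ((a /ℕ m) * + m) ⟩
      (a /ℕ m) * + m                          ∎)))
      where
      open ≡-Reasoning
      cancel : ∀ r x → r + x - r ≡ x
      cancel = solve-∀

    ≡-mod-canonical : ∀ {a b} → a ℕ.< m → b ℕ.< m → + a ≡ + b mod m → a ≡ b
    ≡-mod-canonical {a} {b} a<m b<m a≡b with ∣ + a - + b ∣ in |a-b|≡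
    ... | zero  = ℤₚ.+-injective (ℤₚ.i-j≡0⇒i≡j (+ a) (+ b) (ℤₚ.∣i∣≡0⇒i≡0 |a-b|≡))
    ... | suc d =
      contradiction (∣⇒≤ (subst (m ∣_) |a-b|≡ (≡0-mod⇒∣ (≡-mod⇒-≡0 a≡b)))) (ℕₚ.<⇒≱ |a-b|<m)
      where
      |a-b|<m : suc d ℕ.< m
      |a-b|<m = subst (ℕ._< m) (trans (cong ∣_∣ (sym (ℤₚ.m-n≡m⊖n a b))) |a-b|≡)
                  (ℕₚ.≤-<-trans (ℤₚ.∣m⊝n∣≤m⊔n a b) (ℕₚ.⊔-lub a<m b<m))

    *-cancelʳ-coprime : ∀ {a b c} → Coprime m ∣ c ∣ → a * c ≡ b * c mod m → a ≡ b mod m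
    *-cancelʳ-coprime {a} {b} {c} coprime ac≡bc = -≡0⇒≡-mod (∣⇒≡0-mod
      (ℤ.coprime-divisor (+ m) c (a - b) coprime
        (subst (λ x → m ∣ ∣ x ∣) (factor a b c) (≡0-mod⇒∣ (≡-mod⇒-≡0 ac≡bc)))))
      where
      factor : ∀ a b c → a * c - b * c ≡ c * (a - b)
      factor = solve-∀

  ≡-mod-∣ : ∀ {m n a b} → n ∣ m → a ≡ b mod m → a ≡ b mod n
  ≡-mod-∣ n∣m (congruent m∣a-b) = congruent (∣-trans (∣ᵤ⇒∣ n∣m) m∣a-b)

  ∸-≡-mod : ∀ {m k n} → m ∣ k → n ℕ.≤ k → + (k ℕ.∸ n) ≡ - + n mod m
  ∸-≡-mod {m} {k} {n} m∣k n≤k = begin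
    + (k ℕ.∸ n)   ≡⟨ ℤₚ.⊖-≥ n≤k ⟨
    k ℤ.⊖ n       ≡⟨ ℤₚ.m-n≡m⊖n k n ⟨
    + k - + n     ≈⟨ +-cong (∣⇒≡0-mod {a = + k} m∣k) (≡-mod-refl {a = - + n}) ⟩
    0ℤ - + n      ≡⟨ ℤₚ.+-identityˡ (- + n) ⟩
    - + n         ∎
    where open ≡-mod-Reasoning m

  *-^ : ∀ a b k → (a * b) ^ k ≡ a ^ k * b ^ k
  *-^ a b zero    = refl
  *-^ a b (suc k) = trans (cong (a * b *_) (*-^ a b k)) (interchange a b (a ^ k) (b ^ k))
    where
    interchange : ∀ a b c d → a * b * (c * d) ≡ a * c * (b * d)
    interchange = solve-∀

  square-^ : ∀ a k → (a * a) ^ k ≡ a ^ (2 ℕ.* k)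
  square-^ a k = begin
    (a * a) ^ k          ≡⟨ *-^ a a k ⟩
    a ^ k * a ^ k        ≡⟨ ℤₚ.^-distribˡ-+-* a k k ⟨
    a ^ (k ℕ.+ k)        ≡⟨ cong (λ j → a ^ (k ℕ.+ j)) (ℕₚ.+-identityʳ k) ⟨
    a ^ (2 ℕ.* k)        ∎
    where open ≡-Reasoning

  -1^-parity : ∀ n → (n ℕ.% 2 ≡ 0 × -1ℤ ^ n ≡ 1ℤ) ⊎ (n ℕ.% 2 ≡ 1 × -1ℤ ^ n ≡ -1ℤ)
  -1^-parity zero          = inj₁ (refl , refl)
  -1^-parity (suc zero)    = inj₂ (refl , refl)
  -1^-parity (suc (suc n)) = Sum.map (Product.map₂ (trans (-1*-1* (-1ℤ ^ n))))
                                     (Product.map₂ (trans (-1*-1* (-1ℤ ^ n)))) (-1^-parity n)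
    where
    -1*-1* : ∀ a → -1ℤ * (-1ℤ * a) ≡ a
    -1*-1* = solve-∀

  -1^≡-1^⇒%2≡ : ∀ {m} → ¬ 1ℤ ≡ -1ℤ mod m → ∀ a b → -1ℤ ^ a ≡ -1ℤ ^ b mod m → a ℕ.% 2 ≡ b ℕ.% 2
  -1^≡-1^⇒%2≡ 1≢-1 a b -1^a≡-1^b with -1^-parity a | -1^-parity b
  ... | inj₁ (a%2≡0 , _)   | inj₁ (b%2≡0 , _)   = trans a%2≡0 (sym b%2≡0)
  ... | inj₂ (a%2≡1 , _)   | inj₂ (b%2≡1 , _)   = trans a%2≡1 (sym b%2≡1)
  ... | inj₁ (_ , -1^a≡1)  | inj₂ (_ , -1^b≡-1) =
    contradiction (≡-mod-trans (≡⇒≡-mod (sym -1^a≡1)) (≡-mod-trans -1^a≡-1^b (≡⇒≡-mod -1^b≡-1)))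
                  1≢-1
  ... | inj₂ (_ , -1^a≡-1) | inj₁ (_ , -1^b≡1)  =
    contradiction (≡-mod-trans (≡⇒≡-mod (sym -1^b≡1)) (≡-mod-trans (≡-mod-sym -1^a≡-1^b) (≡⇒≡-mod -1^a≡-1)))
                  1≢-1

  ∏ : (A → ℤ) → List A → ℤ
  ∏ F xs = foldr _*_ 1ℤ (map F xs)

  ∏-↭ : ∀ (F : A → ℤ) {xs ys} → xs ↭ ys → ∏ F xs ≡ ∏ F ys
  ∏-↭ F xs↭ys = foldr-commMonoid (setoid ℤ) ℤₚ.*-1-isCommutativeMonoid (↭⇒↭ₛ (↭.map⁺ F xs↭ys))

  ∏-++ : ∀ (F : A → ℤ) xs {ys} → ∏ F (xs ++ ys) ≡ ∏ F xs * ∏ F ys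
  ∏-++ F []       {ys} = sym (ℤₚ.*-identityˡ (∏ F ys))
  ∏-++ F (x ∷ xs) {ys} =
    trans (cong (F x *_) (∏-++ F xs)) (sym (ℤₚ.*-assoc (F x) (∏ F xs) (∏ F ys)))

  ∏-map : ∀ (F : B → ℤ) (g : A → B) xs → ∏ F (map g xs) ≡ ∏ (F ∘ g) xs
  ∏-map F g xs = cong (foldr _*_ 1ℤ) (sym (map-∘ xs))

  ∏-* : ∀ (F G : A → ℤ) xs → ∏ (λ x → F x * G x) xs ≡ ∏ F xs * ∏ G xs
  ∏-* F G []       = refl
  ∏-* F G (x ∷ xs) =
    trans (cong (F x * G x *_) (∏-* F G xs)) (interchange (F x) (G x) (∏ F xs) (∏ G xs))
    where
    interchange : ∀ a b c d → a * b * (c * d) ≡ a * c * (b * d)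
    interchange = solve-∀

  ∏-const : ∀ c (xs : List A) → ∏ (λ _ → c) xs ≡ c ^ length xs
  ∏-const c []       = refl
  ∏-const c (x ∷ xs) = cong (c *_) (∏-const c xs)

  ∏-cong : ∀ {m} {F G : A → ℤ} xs → (∀ {x} → x ∈ xs → F x ≡ G x mod m) → ∏ F xs ≡ ∏ G xs mod m
  ∏-cong []       F≡G = ≡-mod-refl
  ∏-cong (x ∷ xs) F≡G = *-cong (F≡G (here refl)) (∏-cong xs (F≡G ∘ there))

  ∏-pairing : ∀ {m} (F : ℕ → ℤ) {σ xs} c → Unique xs → FixedPointFreeInvolution σ xs
            → (∀ {x} → x ∈ xs → F x * F (σ x) ≡ c mod m)
            → ∃ λ k → length xs ≡ k ℕ.+ k × (∏ F xs ≡ c ^ k mod m)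
  ∏-pairing {m} F {σ} {xs} c xs! involution pair-product =
    length lower , length≡2*length-lower-half involution xs! , (begin
      ∏ F xs                            ≡⟨ ∏-↭ F (filter-++-filter-∁-↭ (lower-half? involution) xs) ⟩
      ∏ F (lower ++ upper)              ≡⟨ ∏-++ F lower ⟩
      ∏ F lower * ∏ F upper             ≡⟨ cong (∏ F lower *_) (∏-↭ F σ-lower↭upper) ⟨
      ∏ F lower * ∏ F (map σ lower)     ≡⟨ cong (∏ F lower *_) (∏-map F σ lower) ⟩
      ∏ F lower * ∏ (F ∘ σ) lower       ≡⟨ ∏-* F (F ∘ σ) lower ⟨
      ∏ (λ x → F x * F (σ x)) lower     ≈⟨ ∏-cong lower (pair-product ∘ lower⊆xs) ⟩
      ∏ (λ _ → c) lower                 ≡⟨ ∏-const c lower ⟩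
      c ^ length lower                  ∎)
    where
    open ≡-mod-Reasoning m
    lower upper : List ℕ
    lower = lower-half involution
    upper = upper-half involution
    lower⊆xs : lower ⊆ xs
    lower⊆xs = proj₁ ∘ ∈-filter⁻ (lower-half? involution) {xs = xs}
    σ-lower↭upper : map σ lower ↭ upper
    σ-lower↭upper = σ-lower-half↭upper-half involution xs!

module PrimeModulus {n : ℕ} (prime : Prime (suc n)) where

  open import Data.Integer using (_+_; _*_; _-_; -_; _^_; ∣_∣)
  open import Data.Integer.Tactic.RingSolver using (solve-∀)
  open import Data.Integer.DivMod using (n%ℕd<d)
  open Congruence

  p : ℕ
  p = suc n

  *≡0⇒≡0⊎≡0 : ∀ {a b} → a * b ≡ 0ℤ mod p → a ≡ 0ℤ mod p ⊎ b ≡ 0ℤ mod p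
  *≡0⇒≡0⊎≡0 {a} {b} ab≡0
    with euclidsLemma ∣ a ∣ ∣ b ∣ prime (subst (p ∣_) (ℤₚ.abs-* a b) (≡0-mod⇒∣ ab≡0))
  ... | inj₁ p∣a = inj₁ (∣⇒≡0-mod p∣a)
  ... | inj₂ p∣b = inj₂ (∣⇒≡0-mod p∣b)

  *-≢0 : ∀ {a b} → ¬ a ≡ 0ℤ mod p → ¬ b ≡ 0ℤ mod p → ¬ a * b ≡ 0ℤ mod p
  *-≢0 a≢0 b≢0 ab≡0 = [ a≢0 , b≢0 ]′ (*≡0⇒≡0⊎≡0 ab≡0)

  square-root≢0 : ∀ {a x} → ¬ a ≡ 0ℤ mod p → x * x ≡ a mod p → ¬ x ≡ 0ℤ mod p
  square-root≢0 {a} {x} a≢0 x²≡a x≡0 = a≢0 (begin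
    a        ≈⟨ x²≡a ⟨
    x * x    ≈⟨ *-congʳ x x≡0 ⟩
    0ℤ * x   ≡⟨ ℤₚ.*-zeroˡ x ⟩
    0ℤ       ∎)
    where open ≡-mod-Reasoning p

  1≢0 : ¬ 1ℤ ≡ 0ℤ mod p
  1≢0 1≡0 = ¬prime[1] (subst Prime (∣1⇒≡1 (≡0-mod⇒∣ 1≡0)) prime)

  -1≢0 : ¬ -1ℤ ≡ 0ℤ mod p
  -1≢0 = 1≢0 ∘ -‿cong

  ^-≢0 : ∀ {a} k → ¬ a ≡ 0ℤ mod p → ¬ a ^ k ≡ 0ℤ mod p
  ^-≢0 zero    a≢0 = 1≢0
  ^-≢0 (suc k) a≢0 = *-≢0 a≢0 (^-≢0 k a≢0)

  *-cancelʳ : ∀ {a b c} → ¬ c ≡ 0ℤ mod p → a * c ≡ b * c mod p → a ≡ b mod p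
  *-cancelʳ {a} {b} {c} c≢0 ac≡bc = -≡0⇒≡-mod ([ id , flip contradiction c≢0 ]′ (*≡0⇒≡0⊎≡0 (begin
    (a - b) * c    ≡⟨ distrib a b c ⟩
    a * c - b * c  ≈⟨ ≡-mod⇒-≡0 ac≡bc ⟩
    0ℤ             ∎)))
    where
    open ≡-mod-Reasoning p
    distrib : ∀ a b c → (a - b) * c ≡ a * c - b * c
    distrib = solve-∀

  x²≡y²⇒x≡±y : ∀ {x y} → x * x ≡ y * y mod p → x ≡ y mod p ⊎ x ≡ - y mod p
  x²≡y²⇒x≡±y {x} {y} x²≡y² with *≡0⇒≡0⊎≡0 (begin
    (x - y) * (x + y)  ≡⟨ difference-of-squares x y ⟩
    x * x - y * y      ≈⟨ ≡-mod⇒-≡0 x²≡y² ⟩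
    0ℤ                 ∎)
    where
    open ≡-mod-Reasoning p
    difference-of-squares : ∀ x y → (x - y) * (x + y) ≡ x * x - y * y
    difference-of-squares = solve-∀
  ... | inj₁ x-y≡0 = inj₁ (-≡0⇒≡-mod x-y≡0)
  ... | inj₂ x+y≡0 = inj₂ (-≡0⇒≡-mod (≡-mod-trans (≡⇒≡-mod (cong (_+_ x) (ℤₚ.neg-involutive y))) x+y≡0))

  units : List ℕ
  units = applyUpTo suc n

  units! : Unique units
  units! = Unique.applyUpTo⁺₁ suc n (λ i<j _ → ℕₚ.<⇒≢ (s≤s i<j))

  length-units : length units ≡ n
  length-units = length-applyUpTo suc n

  ∈-units⁺ : ∀ {y} → 0 ℕ.< y → y ℕ.< p → y ∈ units
  ∈-units⁺ {suc y} _ (s≤s y<n) = ∈-applyUpTo⁺ suc y<n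

  ∈-units⁻ : ∀ {y} → y ∈ units → 0 ℕ.< y × y ℕ.< p
  ∈-units⁻ y∈ with i , i<n , refl ← ∈-applyUpTo⁻ suc y∈ = s≤s z≤n , s≤s i<n

  unit≢0 : ∀ {y} → y ∈ units → ¬ + y ≡ 0ℤ mod p
  unit≢0 y∈ y≡0 = let 0<y , y<p = ∈-units⁻ y∈ in ℕₚ.<⇒≱ y<p (∣⇒≤ ⦃ ℕ.>-nonZero 0<y ⦄ (≡0-mod⇒∣ y≡0))

  residue-≡ : ∀ a → + residue a p ≡ a mod p
  residue-≡ a = %ℕ-≡-mod a

  residue-< : ∀ a → residue a p ℕ.< p
  residue-< a = n%ℕd<d a p

  residue∈units : ∀ {a} → ¬ a ≡ 0ℤ mod p → residue a p ∈ units
  residue∈units {a} a≢0 with residue a p in r≡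
  ... | zero  = contradiction (≡-mod-trans (≡-mod-sym (residue-≡ a)) (≡⇒≡-mod (cong +_ r≡))) a≢0
  ... | suc r = ∈-units⁺ (s≤s z≤n) (subst (ℕ._< p) r≡ (residue-< a))

  ∏-≢0 : ∀ xs → (∀ {x} → x ∈ xs → ¬ + x ≡ 0ℤ mod p) → ¬ ∏ +_ xs ≡ 0ℤ mod p
  ∏-≢0 []       _   = 1≢0
  ∏-≢0 (x ∷ xs) x≢0 = *-≢0 (x≢0 (here refl)) (∏-≢0 xs (x≢0 ∘ there))

  ≡-mod⇒residue≡ : ∀ {a b} → a ≡ b mod p → residue a p ≡ residue b p
  ≡-mod⇒residue≡ {a} {b} a≡b = ≡-mod-canonical (residue-< a) (residue-< b)
    (≡-mod-trans (residue-≡ a) (≡-mod-trans a≡b (≡-mod-sym (residue-≡ b))))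

  multiply-by : ℤ → ℕ → ℕ
  multiply-by a y = residue (a * + y) p

  multiply-by-injective : ∀ {a} → ¬ a ≡ 0ℤ mod p → InjectiveOn (multiply-by a) units
  multiply-by-injective {a} a≢0 {x} {y} x∈ y∈ ax≡ay =
    ≡-mod-canonical (proj₂ (∈-units⁻ x∈)) (proj₂ (∈-units⁻ y∈)) (*-cancelʳ a≢0 (begin
      + x * a            ≡⟨ ℤₚ.*-comm (+ x) a ⟩
      a * + x            ≈⟨ residue-≡ (a * + x) ⟨
      + multiply-by a x  ≡⟨ cong +_ ax≡ay ⟩
      + multiply-by a y  ≈⟨ residue-≡ (a * + y) ⟩
      a * + y            ≡⟨ ℤₚ.*-comm a (+ y) ⟩
      + y * a            ∎))
    where open ≡-mod-Reasoning p

  multiply-by-permutes-units : ∀ {a} → ¬ a ≡ 0ℤ mod p → map (multiply-by a) units ↭ units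
  multiply-by-permutes-units a≢0 = injectiveOn⇒map↭ units!
    (λ y∈ → residue∈units (*-≢0 a≢0 (unit≢0 y∈))) (multiply-by-injective a≢0)

  fermat : ∀ {a} → ¬ a ≡ 0ℤ mod p → a ^ n ≡ 1ℤ mod p
  fermat {a} a≢0 = *-cancelʳ (∏-≢0 units unit≢0) (begin
    a ^ n * ∏ +_ units                      ≡⟨ cong (λ k → a ^ k * ∏ +_ units) length-units ⟨
    a ^ length units * ∏ +_ units           ≡⟨ cong (_* ∏ +_ units) (∏-const a units) ⟨
    ∏ (λ _ → a) units * ∏ +_ units          ≡⟨ ∏-* (λ _ → a) +_ units ⟨
    ∏ (λ y → a * + y) units                 ≈⟨ ∏-cong units (λ {y} _ → residue-≡ (a * + y)) ⟨
    ∏ (+_ ∘ multiply-by a) units            ≡⟨ ∏-map +_ (multiply-by a) units ⟨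
    ∏ +_ (map (multiply-by a) units)        ≡⟨ ∏-↭ +_ (multiply-by-permutes-units a≢0) ⟩
    ∏ +_ units                              ≡⟨ ℤₚ.*-identityˡ (∏ +_ units) ⟨
    1ℤ * ∏ +_ units                         ∎)
    where open ≡-mod-Reasoning p

  -- a^(p−2), the inverse of a modulo p by Fermat's theorem when a ≢ 0
  _⁻¹ : ℤ → ℤ
  a ⁻¹ = a ^ ℕ.pred n

  ⁻¹-inverseʳ : ∀ {a} → ¬ a ≡ 0ℤ mod p → a * a ⁻¹ ≡ 1ℤ mod p
  ⁻¹-inverseʳ {a} a≢0 = ≡-mod-trans (≡⇒≡-mod (cong (a ^_) (ℕₚ.suc-pred n ⦃ n≢0 ⦄))) (fermat a≢0)
    where
    n≢0 : ℕ.NonZero n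
    n≢0 = ℕ.≢-nonZero (λ n≡0 → ¬prime[1] (subst (Prime ∘ suc) n≡0 prime))

  ⁻¹-≢0 : ∀ {a} → ¬ a ≡ 0ℤ mod p → ¬ a ⁻¹ ≡ 0ℤ mod p
  ⁻¹-≢0 {a} a≢0 = ^-≢0 (ℕ.pred n) a≢0

  IsSquare : ℤ → Set
  IsSquare a = ∃ λ x → x * x ≡ a mod p

  IsSquare-resp : ∀ {a b} → a ≡ b mod p → IsSquare a → IsSquare b
  IsSquare-resp a≡b (x , x²≡a) = x , ≡-mod-trans x²≡a a≡b

  square-* : ∀ {a b} → IsSquare a → IsSquare b → IsSquare (a * b)
  square-* (x , x²≡a) (y , y²≡b) = x * y , ≡-mod-trans (≡⇒≡-mod (interchange x y)) (*-cong x²≡a y²≡b)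
    where
    interchange : ∀ x y → x * y * (x * y) ≡ x * x * (y * y)
    interchange = solve-∀

  isSquareMod⇒isSquare : ∀ {μ} → IsSquareMod p μ → IsSquare (+ μ)
  isSquareMod⇒isSquare {μ} square with x , x²≡μ ← Any.satisfied square = + x , (begin
    + x * + x           ≡⟨ ℤₚ.pos-* x x ⟨
    + (x ℕ.* x)         ≈⟨ residue-≡ (+ (x ℕ.* x)) ⟨
    + residue (+ (x ℕ.* x)) p ≡⟨ cong +_ x²≡μ ⟩
    + residue (+ μ) p   ≈⟨ residue-≡ (+ μ) ⟩
    + μ                 ∎)
    where open ≡-mod-Reasoning p

  isSquare⇒isSquareMod : ∀ {μ} → IsSquare (+ μ) → IsSquareMod p μ
  isSquare⇒isSquareMod {μ} (x , x²≡μ) = lose (∈-upTo⁺ (residue-< x)) (≡-mod⇒residue≡ (begin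
    + (residue x p ℕ.* residue x p)   ≡⟨ ℤₚ.pos-* (residue x p) (residue x p) ⟩
    + residue x p * + residue x p     ≈⟨ *-cong (residue-≡ x) (residue-≡ x) ⟩
    x * x                             ≈⟨ x²≡μ ⟩
    + μ                               ∎))
    where open ≡-mod-Reasoning p

  isSquare? : Decidable IsSquare
  isSquare? a = map′ (IsSquare-resp (residue-≡ a) ∘ isSquareMod⇒isSquare)
                     (isSquare⇒isSquareMod ∘ IsSquare-resp (≡-mod-sym (residue-≡ a)))
                     (isSquareMod? p (residue a p))

  legendre≡1⇔ : ∀ {μ} → legendre p μ ≡ 1ℤ ⇔ (¬ p ∣ μ × IsSquare (+ μ))
  legendre≡1⇔ {μ} = mk⇔ to from
    where
    to : legendre p μ ≡ 1ℤ → ¬ p ∣ μ × IsSquare (+ μ)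
    to legendre≡1 with p ∣? μ
    ... | no p∤μ with isSquareMod? p μ
    ...   | yes μ□ = p∤μ , isSquareMod⇒isSquare μ□
    from : ¬ p ∣ μ × IsSquare (+ μ) → legendre p μ ≡ 1ℤ
    from (p∤μ , μ□) with p ∣? μ
    ... | yes p∣μ = contradiction p∣μ p∤μ
    ... | no _ with isSquareMod? p μ
    ...   | yes _  = refl
    ...   | no μ̸□ = contradiction (isSquare⇒isSquareMod μ□) μ̸□

  legendre≡-1⇔ : ∀ {μ} → legendre p μ ≡ -1ℤ ⇔ (¬ p ∣ μ × ¬ IsSquare (+ μ))
  legendre≡-1⇔ {μ} = mk⇔ to from
    where
    to : legendre p μ ≡ -1ℤ → ¬ p ∣ μ × ¬ IsSquare (+ μ)
    to legendre≡-1 with p ∣? μ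
    ... | no p∤μ with isSquareMod? p μ
    ...   | no μ̸□ = p∤μ , μ̸□ ∘ isSquare⇒isSquareMod
    from : ¬ p ∣ μ × ¬ IsSquare (+ μ) → legendre p μ ≡ -1ℤ
    from (p∤μ , μ̸□) with p ∣? μ
    ... | yes p∣μ = contradiction p∣μ p∤μ
    ... | no _ with isSquareMod? p μ
    ...   | yes μ□ = contradiction (isSquareMod⇒isSquare μ□) μ̸□
    ...   | no _   = refl

  legendre-*-square : ∀ {a μ ν} → ¬ a ≡ 0ℤ mod p → IsSquare a → + ν ≡ a * + μ mod p
                    → legendre p ν ≡ legendre p μ
  legendre-*-square {a} {μ} {ν} a≢0 (y , y²≡a) ν≡aμ = legendre-cong
    (mk⇔ (≡0-mod⇒∣ ∘ ν≡0⇒μ≡0 ∘ ∣⇒≡0-mod) (≡0-mod⇒∣ ∘ μ≡0⇒ν≡0 ∘ ∣⇒≡0-mod))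
    (mk⇔ (isSquare⇒isSquareMod ∘ ν□⇒μ□ ∘ isSquareMod⇒isSquare)
         (isSquare⇒isSquareMod ∘ μ□⇒ν□ ∘ isSquareMod⇒isSquare))
    where
    open ≡-mod-Reasoning p
    μ≡0⇒ν≡0 : + μ ≡ 0ℤ mod p → + ν ≡ 0ℤ mod p
    μ≡0⇒ν≡0 μ≡0 = begin
      + ν      ≈⟨ ν≡aμ ⟩
      a * + μ  ≈⟨ *-congˡ a μ≡0 ⟩
      a * 0ℤ   ≡⟨ ℤₚ.*-zeroʳ a ⟩
      0ℤ       ∎
    ν≡0⇒μ≡0 : + ν ≡ 0ℤ mod p → + μ ≡ 0ℤ mod p
    ν≡0⇒μ≡0 ν≡0 = *-cancelʳ a≢0 (begin
      + μ * a  ≡⟨ ℤₚ.*-comm (+ μ) a ⟩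
      a * + μ  ≈⟨ ν≡aμ ⟨
      + ν      ≈⟨ ν≡0 ⟩
      0ℤ       ≡⟨ ℤₚ.*-zeroˡ a ⟨
      0ℤ * a   ∎)
    μ□⇒ν□ : IsSquare (+ μ) → IsSquare (+ ν)
    μ□⇒ν□ (x , x²≡μ) = y * x , (begin
      y * x * (y * x)    ≡⟨ interchange y x ⟩
      y * y * (x * x)    ≈⟨ *-cong y²≡a x²≡μ ⟩
      a * + μ            ≈⟨ ν≡aμ ⟨
      + ν                ∎)
      where
      interchange : ∀ y x → y * x * (y * x) ≡ y * y * (x * x)
      interchange = solve-∀
    ν□⇒μ□ : IsSquare (+ ν) → IsSquare (+ μ)
    ν□⇒μ□ (z , z²≡ν) = z * y ⁻¹ , *-cancelʳ a≢0 (begin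
      z * y ⁻¹ * (z * y ⁻¹) * a            ≈⟨ *-congˡ (z * y ⁻¹ * (z * y ⁻¹)) y²≡a ⟨
      z * y ⁻¹ * (z * y ⁻¹) * (y * y)      ≡⟨ regroup z y (y ⁻¹) ⟩
      z * z * ((y * y ⁻¹) * (y * y ⁻¹))    ≈⟨ *-cong z²≡ν (*-cong (⁻¹-inverseʳ y≢0) (⁻¹-inverseʳ y≢0)) ⟩
      + ν * (1ℤ * 1ℤ)                      ≡⟨ ℤₚ.*-identityʳ (+ ν) ⟩
      + ν                                  ≈⟨ ν≡aμ ⟩
      a * + μ                              ≡⟨ ℤₚ.*-comm a (+ μ) ⟩
      + μ * a                              ∎)
      where
      y≢0 : ¬ y ≡ 0ℤ mod p
      y≢0 = square-root≢0 a≢0 y²≡a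
      regroup : ∀ z y y⁻¹ → z * y⁻¹ * (z * y⁻¹) * (y * y) ≡ z * z * ((y * y⁻¹) * (y * y⁻¹))
      regroup = solve-∀

  partner : ℤ → ℕ → ℕ
  partner c y = residue (c * (+ y) ⁻¹) p

  module _ {c} (c≢0 : ¬ c ≡ 0ℤ mod p) where

    partner∈units : ∀ {y} → y ∈ units → partner c y ∈ units
    partner∈units y∈ = residue∈units (*-≢0 c≢0 (⁻¹-≢0 (unit≢0 y∈)))

    partner-product : ∀ {y} → y ∈ units → + y * + partner c y ≡ c mod p
    partner-product {y} y∈ = begin
      + y * + partner c y      ≈⟨ *-congˡ (+ y) (residue-≡ (c * (+ y) ⁻¹)) ⟩
      + y * (c * (+ y) ⁻¹)     ≡⟨ swap (+ y) c ((+ y) ⁻¹) ⟩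
      c * (+ y * (+ y) ⁻¹)     ≈⟨ *-congˡ c (⁻¹-inverseʳ (unit≢0 y∈)) ⟩
      c * 1ℤ                   ≡⟨ ℤₚ.*-identityʳ c ⟩
      c                        ∎
      where
      open ≡-mod-Reasoning p
      swap : ∀ y c y⁻¹ → y * (c * y⁻¹) ≡ c * (y * y⁻¹)
      swap = solve-∀

    partner-unique : ∀ {y z} → y ∈ units → z ℕ.< p → + y * + z ≡ c mod p → partner c y ≡ z
    partner-unique {y} {z} y∈ z<p yz≡c =
      ≡-mod-canonical (residue-< (c * (+ y) ⁻¹)) z<p (*-cancelʳ (unit≢0 y∈) (begin
      + partner c y * + y   ≡⟨ ℤₚ.*-comm (+ partner c y) (+ y) ⟩
      + y * + partner c y   ≈⟨ partner-product y∈ ⟩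
      c                     ≈⟨ yz≡c ⟨
      + y * + z             ≡⟨ ℤₚ.*-comm (+ y) (+ z) ⟩
      + z * + y             ∎))
      where open ≡-mod-Reasoning p

    partner-involutive : ∀ {y} → y ∈ units → partner c (partner c y) ≡ y
    partner-involutive {y} y∈ = partner-unique (partner∈units y∈) (proj₂ (∈-units⁻ y∈))
      (≡-mod-trans (≡⇒≡-mod (ℤₚ.*-comm (+ partner c y) (+ y))) (partner-product y∈))

    partner-fixed⇒square : ∀ {y} → y ∈ units → partner c y ≡ y → + y * + y ≡ c mod p
    partner-fixed⇒square {y} y∈ σy≡y = subst (λ z → + y * + z ≡ c mod p) σy≡y (partner-product y∈)

module OddPrimeModulus {m : ℕ} (prime : Prime (suc (2 ℕ.* m))) where

  open import Data.Integer using (_+_; _*_; _-_; -_; _^_; ∣_∣)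
  open import Data.Integer.Tactic.RingSolver using (solve-∀)
  open Congruence
  open PrimeModulus prime

  2m≡-1 : + (2 ℕ.* m) ≡ -1ℤ mod p
  2m≡-1 = -≡0⇒≡-mod (∣⇒≡0-mod (subst (p ∣_) (cong ∣_∣ p≡2m+1) ∣-refl))
    where
    p≡2m+1 : + p ≡ + (2 ℕ.* m) - -1ℤ
    p≡2m+1 = trans (cong +_ (ℕₚ.+-comm 1 (2 ℕ.* m))) (ℤₚ.pos-+ (2 ℕ.* m) 1)

  0<m : 0 ℕ.< m
  0<m = ℕₚ.n≢0⇒n>0 (λ m≡0 → ¬prime[1] (subst (λ m → Prime (suc (2 ℕ.* m))) m≡0 prime))

  1<2m : 1 ℕ.< 2 ℕ.* m
  1<2m = ℕₚ.*-monoʳ-≤ 2 {1} {m} 0<m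

  1≢-1 : ¬ 1ℤ ≡ -1ℤ mod p
  1≢-1 1≡-1 = ℕₚ.<⇒≱ (s≤s 1<2m) (∣⇒≤ (≡0-mod⇒∣ (≡-mod⇒-≡0 1≡-1)))

  1∈units : 1 ∈ units
  1∈units = ∈-units⁺ (s≤s z≤n) (s≤s (ℕₚ.<-trans (s≤s z≤n) 1<2m))

  2m∈units : 2 ℕ.* m ∈ units
  2m∈units = ∈-units⁺ (ℕₚ.<-trans (s≤s z≤n) 1<2m) (ℕₚ.n<1+n _)

  unit≡±1⇒≡1⊎≡2m : ∀ {y} → y ∈ units → + y ≡ 1ℤ mod p ⊎ + y ≡ -1ℤ mod p → y ≡ 1 ⊎ y ≡ 2 ℕ.* m
  unit≡±1⇒≡1⊎≡2m y∈ = Sum.map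
    (≡-mod-canonical (proj₂ (∈-units⁻ y∈)) (proj₂ (∈-units⁻ 1∈units)))
    (λ y≡-1 → ≡-mod-canonical (proj₂ (∈-units⁻ y∈)) (ℕₚ.n<1+n _) (≡-mod-trans y≡-1 (≡-mod-sym 2m≡-1)))

  self-inverse⇔ : ∀ {y} → y ∈ units → partner 1ℤ y ≡ y ⇔ (y ≡ 1 ⊎ y ≡ 2 ℕ.* m)
  self-inverse⇔ {y} y∈ = mk⇔
    (λ σy≡y → unit≡±1⇒≡1⊎≡2m y∈ (x²≡y²⇒x≡±y (partner-fixed⇒square 1≢0 y∈ σy≡y)))
    λ { (inj₁ refl) → partner-unique 1≢0 y∈ (proj₂ (∈-units⁻ y∈)) ≡-mod-refl
      ; (inj₂ refl) → partner-unique 1≢0 y∈ (proj₂ (∈-units⁻ y∈)) (*-cong 2m≡-1 2m≡-1) }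

  ±1? : Decidable (λ y → y ≡ 1 ⊎ y ≡ 2 ℕ.* m)
  ±1? y = (y ℕ.≟ 1) ⊎-dec (y ℕ.≟ 2 ℕ.* m)

  ±1s others : List ℕ
  ±1s    = filter ±1? units
  others = filter (∁? ±1?) units

  ±1s↭ : 1 ∷ 2 ℕ.* m ∷ [] ↭ ±1s
  ±1s↭ = unique-⊆-length≥⇒↭ ((ℕₚ.<⇒≢ 1<2m ∷ []) ∷ [] ∷ []) listed⊆±1s
    (unique-⊆⇒length≤ (Unique.filter⁺ ±1? units!) ±1s⊆listed)
    where
    listed⊆±1s : 1 ∷ 2 ℕ.* m ∷ [] ⊆ ±1s
    listed⊆±1s (here refl)         = ∈-filter⁺ ±1? 1∈units (inj₁ refl)
    listed⊆±1s (there (here refl)) = ∈-filter⁺ ±1? 2m∈units (inj₂ refl)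
    ±1s⊆listed : ±1s ⊆ 1 ∷ 2 ℕ.* m ∷ []
    ±1s⊆listed y∈ with proj₂ (∈-filter⁻ ±1? {xs = units} y∈)
    ... | inj₁ refl = here refl
    ... | inj₂ refl = there (here refl)

  others⊆units : others ⊆ units
  others⊆units = proj₁ ∘ ∈-filter⁻ (∁? ±1?) {xs = units}

  ∉±1s : ∀ {y} → y ∈ others → ¬ (y ≡ 1 ⊎ y ≡ 2 ℕ.* m)
  ∉±1s = proj₂ ∘ ∈-filter⁻ (∁? ±1?) {xs = units}

  inverse-involution : FixedPointFreeInvolution (partner 1ℤ) others
  inverse-involution = record
    { σ-closed         = σ-closed
    ; σ-involutive     = partner-involutive 1≢0 ∘ others⊆units
    ; fixed-point-free = λ y∈ → ∉±1s y∈ ∘ Equivalence.to (self-inverse⇔ (others⊆units y∈))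
    }
    where
    σ-closed : ∀ {y} → y ∈ others → partner 1ℤ y ∈ others
    σ-closed {y} y∈ = ∈-filter⁺ (∁? ±1?) σy∈units λ σy≡±1 → ∉±1s y∈
      (Equivalence.to (self-inverse⇔ y∈units)
        (trans (sym (Equivalence.from (self-inverse⇔ σy∈units) σy≡±1)) (partner-involutive 1≢0 y∈units)))
      where
      y∈units : y ∈ units
      y∈units = others⊆units y∈
      σy∈units : partner 1ℤ y ∈ units
      σy∈units = partner∈units 1≢0 y∈units

  wilson : ∏ +_ units ≡ -1ℤ mod p
  wilson =
    let k , _ , ∏-others≡1^k = ∏-pairing +_ 1ℤ (Unique.filter⁺ (∁? ±1?) units!) inverse-involution
                                          (partner-product 1≢0 ∘ others⊆units)
    in begin
    ∏ +_ units                             ≡⟨ ∏-↭ +_ (filter-++-filter-∁-↭ ±1? units) ⟩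
    ∏ +_ (±1s ++ others)                   ≡⟨ ∏-++ +_ ±1s ⟩
    ∏ +_ ±1s * ∏ +_ others                 ≡⟨ cong (_* ∏ +_ others) (∏-↭ +_ ±1s↭) ⟨
    1ℤ * (+ (2 ℕ.* m) * 1ℤ) * ∏ +_ others  ≈⟨ *-cong (*-congˡ 1ℤ (*-congʳ 1ℤ 2m≡-1)) ∏-others≡1^k ⟩
    -1ℤ * 1ℤ ^ k                           ≡⟨ cong (-1ℤ *_) (ℤₚ.^-zeroˡ k) ⟩
    -1ℤ                                    ∎
    where open ≡-mod-Reasoning p

  square⇒^m≡1 : ∀ {a} → ¬ a ≡ 0ℤ mod p → IsSquare a → a ^ m ≡ 1ℤ mod p
  square⇒^m≡1 {a} a≢0 (x , x²≡a) = begin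
    a ^ m              ≈⟨ ^-cong m x²≡a ⟨
    (x * x) ^ m        ≡⟨ square-^ x m ⟩
    x ^ (2 ℕ.* m)      ≈⟨ fermat (square-root≢0 a≢0 x²≡a) ⟩
    1ℤ                 ∎
    where open ≡-mod-Reasoning p

  nonsquare⇒^m≡-1 : ∀ {a} → ¬ IsSquare a → a ^ m ≡ -1ℤ mod p
  nonsquare⇒^m≡-1 {a} a̸□ =
    let k , 2m≡k+k , ∏≡a^k = ∏-pairing +_ a units! involution (partner-product a≢0) in begin
    a ^ m         ≡⟨ cong (a ^_) (+-self-injective {m} {k} (trans m+m≡2m (trans (sym length-units) 2m≡k+k))) ⟩
    a ^ k         ≈⟨ ∏≡a^k ⟨
    ∏ +_ units    ≈⟨ wilson ⟩
    -1ℤ           ∎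
    where
    open ≡-mod-Reasoning p
    m+m≡2m : m ℕ.+ m ≡ 2 ℕ.* m
    m+m≡2m = cong (m ℕ.+_) (sym (ℕₚ.+-identityʳ m))
    a≢0 : ¬ a ≡ 0ℤ mod p
    a≢0 a≡0 = a̸□ (0ℤ , ≡-mod-sym a≡0)
    involution : FixedPointFreeInvolution (partner a) units
    involution = record
      { σ-closed         = partner∈units a≢0
      ; σ-involutive     = partner-involutive a≢0
      ; fixed-point-free = λ {y} y∈ σy≡y → a̸□ (+ y , partner-fixed⇒square a≢0 y∈ σy≡y)
      }

  ^m≡1⇒square : ∀ {a} → a ^ m ≡ 1ℤ mod p → IsSquare a
  ^m≡1⇒square {a} a^m≡1 = decidable-stable (isSquare? a)
    (λ a̸□ → 1≢-1 (≡-mod-trans (≡-mod-sym a^m≡1) (nonsquare⇒^m≡-1 a̸□)))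

  residue? : Decidable (λ μ → legendre p μ ≡ 1ℤ)
  residue? μ = legendre p μ ℤ.≟ 1ℤ

  nonresidue? : Decidable (λ μ → legendre p μ ≡ -1ℤ)
  nonresidue? μ = legendre p μ ℤ.≟ -1ℤ

  lower-units : List ℕ
  lower-units = applyUpTo suc m

  ∈-lower-units⁺ : ∀ {x} → 0 ℕ.< x → x ℕ.≤ m → x ∈ lower-units
  ∈-lower-units⁺ {suc x} _ x<m = ∈-applyUpTo⁺ suc x<m

  ∈-lower-units⁻ : ∀ {x} → x ∈ lower-units → 0 ℕ.< x × x ℕ.≤ m
  ∈-lower-units⁻ x∈ with i , i<m , refl ← ∈-applyUpTo⁻ suc x∈ = s≤s z≤n , i<m

  ∈-lower⇒∈-units : ∀ {x} → x ∈ lower-units → x ∈ units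
  ∈-lower⇒∈-units x∈ = let 0<x , x≤m = ∈-lower-units⁻ x∈ in
    ∈-units⁺ 0<x (s≤s (ℕₚ.≤-trans x≤m (ℕₚ.m≤n*m m 2)))

  lower-representative : ∀ {y} → y ∈ units → ∃ λ w → w ∈ lower-units × + w * + w ≡ + y * + y mod p
  lower-representative {y} y∈ with y ℕ.≤? m
  ... | yes y≤m = y , ∈-lower-units⁺ (proj₁ (∈-units⁻ y∈)) y≤m , ≡-mod-refl
  ... | no  y≰m = p ℕ.∸ y , ∈-lower-units⁺ (ℕₚ.m<n⇒0<n∸m y<p) p-y≤m , (begin
    + (p ℕ.∸ y) * + (p ℕ.∸ y)   ≈⟨ *-cong (∸-≡-mod ∣-refl (ℕₚ.<⇒≤ y<p)) (∸-≡-mod ∣-refl (ℕₚ.<⇒≤ y<p)) ⟩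
    - + y * - + y               ≡⟨ neg-square (+ y) ⟩
    + y * + y                   ∎)
    where
    open ≡-mod-Reasoning p
    y<p : y ℕ.< p
    y<p = proj₂ (∈-units⁻ y∈)
    p≤y+m : p ℕ.≤ y ℕ.+ m
    p≤y+m = subst (ℕ._≤ y ℕ.+ m) (cong (λ j → suc (m ℕ.+ j)) (sym (ℕₚ.+-identityʳ m)))
              (ℕₚ.+-monoˡ-≤ m (ℕₚ.≰⇒> y≰m))
    p-y≤m : p ℕ.∸ y ℕ.≤ m
    p-y≤m = ℕₚ.m≤n+o⇒m∸n≤o p y p≤y+m
    neg-square : ∀ a → - a * - a ≡ a * a
    neg-square = solve-∀

  square-residue : ℕ → ℕ
  square-residue x = residue (+ x * + x) p

  square-residue-≡ : ∀ x → + square-residue x ≡ + x * + x mod p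
  square-residue-≡ x = residue-≡ (+ x * + x)

  square-residue-injective : InjectiveOn square-residue lower-units
  square-residue-injective {x} {y} x∈ y∈ x²≡y² =
    [ ≡-mod-canonical (proj₂ (∈-units⁻ (∈-lower⇒∈-units x∈))) (proj₂ (∈-units⁻ (∈-lower⇒∈-units y∈)))
    , flip contradiction x≢-y
    ]′ (x²≡y²⇒x≡±y (begin
      + x * + x              ≈⟨ square-residue-≡ x ⟨
      + square-residue x     ≡⟨ cong +_ x²≡y² ⟩
      + square-residue y     ≈⟨ square-residue-≡ y ⟩
      + y * + y              ∎))
    where
    open ≡-mod-Reasoning p
    x+y<p : x ℕ.+ y ℕ.< p
    x+y<p = s≤s (subst (x ℕ.+ y ℕ.≤_) (cong (m ℕ.+_) (sym (ℕₚ.+-identityʳ m)))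
              (ℕₚ.+-mono-≤ (proj₂ (∈-lower-units⁻ x∈)) (proj₂ (∈-lower-units⁻ y∈))))
    x≢-y : ¬ + x ≡ - + y mod p
    x≢-y x≡-y = unit≢0 (∈-units⁺ (ℕₚ.<-≤-trans (proj₁ (∈-lower-units⁻ x∈)) (ℕₚ.m≤m+n x y)) x+y<p) (begin
      + (x ℕ.+ y)   ≡⟨ ℤₚ.pos-+ x y ⟩
      + x + + y     ≈⟨ +-cong x≡-y (≡-mod-refl {a = + y}) ⟩
      - + y + + y   ≡⟨ ℤₚ.+-inverseˡ (+ y) ⟩
      0ℤ            ∎)

  square∈residues : ∀ {x} → x ∈ lower-units → square-residue x ∈ filter residue? (upTo p)
  square∈residues {x} x∈ = ∈-filter⁺ residue? (∈-upTo⁺ (residue-< (+ x * + x)))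
    (Equivalence.from legendre≡1⇔ (x²≢0 ∘ ∣⇒≡0-mod , (+ x , ≡-mod-sym (square-residue-≡ x))))
    where
    x≢0 : ¬ + x ≡ 0ℤ mod p
    x≢0 = unit≢0 (∈-lower⇒∈-units x∈)
    x²≢0 : ¬ + square-residue x ≡ 0ℤ mod p
    x²≢0 x²≡0 = *-≢0 x≢0 x≢0 (≡-mod-trans (≡-mod-sym (square-residue-≡ x)) x²≡0)

  residue∈squares : ∀ {z} → z ∈ filter residue? (upTo p) → z ∈ map square-residue lower-units
  residue∈squares {z} z∈ =
    let z∈upTo , legendre≡1 = ∈-filter⁻ residue? {xs = upTo p} z∈
        p∤z , x , x²≡z      = Equivalence.to (legendre≡1⇔ {z}) legendre≡1
        x≢0                 = square-root≢0 {+ z} (p∤z ∘ ≡0-mod⇒∣) x²≡z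
        w , w∈ , w²≡x̄²      = lower-representative (residue∈units {x} x≢0)
    in subst (_∈ map square-residue lower-units)
         (≡-mod-canonical (residue-< (+ w * + w)) (∈-upTo⁻ z∈upTo) (begin
           + square-residue w                  ≈⟨ square-residue-≡ w ⟩
           + w * + w                           ≈⟨ w²≡x̄² ⟩
           + residue x p * + residue x p       ≈⟨ *-cong (residue-≡ x) (residue-≡ x) ⟩
           x * x                               ≈⟨ x²≡z ⟩
           + z                                 ∎))
         (∈-map⁺ square-residue w∈)
    where open ≡-mod-Reasoning p

  squares↭residues : map square-residue lower-units ↭ filter residue? (upTo p)
  squares↭residues = unique-⊆-length≥⇒↭
    (map-unique square-residue-injective (Unique.applyUpTo⁺₁ suc m (λ i<j _ → ℕₚ.<⇒≢ (s≤s i<j))))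
    (map-⊆ square∈residues)
    (unique-⊆⇒length≤ (Unique.filter⁺ residue? (Unique.upTo⁺ p)) residue∈squares)

  count-residues : count residue? (upTo p) ≡ m
  count-residues = begin
    count residue? (upTo p)                    ≡⟨ ↭-length squares↭residues ⟨
    length (map square-residue lower-units)    ≡⟨ length-map square-residue lower-units ⟩
    length lower-units                         ≡⟨ length-applyUpTo suc m ⟩
    m                                          ∎
    where open ≡-Reasoning

  count-nonresidues : count nonresidue? (upTo p) ≡ m
  count-nonresidues = ℕₚ.+-cancelˡ-≡ m _ _ (begin
    m ℕ.+ count nonresidue? (upTo p)
      ≡⟨ cong (ℕ._+ count nonresidue? (upTo p)) count-residues ⟨
    count residue? (upTo p) ℕ.+ count nonresidue? (upTo p)
      ≡⟨ count-⊎ p∤? residue? nonresidue? residue-or-nonresidue ±1⇒p∤ (λ {μ} → disjoint {μ}) (upTo p) ⟨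
    count p∤? (upTo p)
      ≡⟨ cong length (filter-reject p∤? {0} {units} (λ p∤0 → p∤0 (p ∣0))) ⟩
    count p∤? units
      ≡⟨ cong length (filter-all p∤? (All.tabulate λ y∈ → unit≢0 y∈ ∘ ∣⇒≡0-mod)) ⟩
    length units
      ≡⟨ length-units ⟩
    2 ℕ.* m
      ≡⟨ cong (m ℕ.+_) (ℕₚ.+-identityʳ m) ⟩
    m ℕ.+ m ∎)
    where
    open ≡-Reasoning
    p∤? : Decidable (λ μ → ¬ p ∣ μ)
    p∤? μ = ¬? (p ∣? μ)
    residue-or-nonresidue : ∀ {μ} → ¬ p ∣ μ → legendre p μ ≡ 1ℤ ⊎ legendre p μ ≡ -1ℤ
    residue-or-nonresidue {μ} p∤μ = Sum.map (Equivalence.from legendre≡1⇔ ∘ (p∤μ ,_))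
                                             (Equivalence.from legendre≡-1⇔ ∘ (p∤μ ,_))
                                             (toSum (isSquare? (+ μ)))
    ±1⇒p∤ : ∀ {μ} → legendre p μ ≡ 1ℤ ⊎ legendre p μ ≡ -1ℤ → ¬ p ∣ μ
    ±1⇒p∤ {μ} = [ proj₁ ∘ Equivalence.to (legendre≡1⇔ {μ}) , proj₁ ∘ Equivalence.to (legendre≡-1⇔ {μ}) ]′
    disjoint : ∀ {μ} → legendre p μ ≡ 1ℤ × legendre p μ ≡ -1ℤ → ⊥
    disjoint (≡1 , ≡-1) with () ← trans (sym ≡1) ≡-1

-- p = 4q + 1 is written suc (2 * (2 * q)) so that PrimeModulus (p = suc n) and
-- OddPrimeModulus (p = suc (2 * m)) apply to it without transport; likewise K = k p with k = suc k-1.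
module TauParity {q : ℕ} (prime : Prime (suc (2 ℕ.* (2 ℕ.* q)))) (k-1 : ℕ) {h : ℤ}
  (K-odd : ¬ 2 ∣ suc k-1 ℕ.* suc (2 ℕ.* (2 ℕ.* q)))
  (h-coprime : Coprime (suc k-1 ℕ.* suc (2 ℕ.* (2 ℕ.* q))) ℤ.∣ h ∣)
  (h-square : PrimeModulus.IsSquare prime h) where

  open import Data.Integer using (_+_; _*_; -_; _^_)
  open import Data.Integer.Tactic.RingSolver using (solve-∀)
  open import Data.Integer.DivMod using (n%ℕd<d)
  open import Data.Nat.Tactic.RingSolver using () renaming (solve-∀ to ℕ-solve-∀)
  open import Data.Nat.Divisibility using (∣m⇒∣m*n)
  open import Data.Nat.DivMod using (m≡m%n+[m/n]*n)
  open Congruence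
  open PrimeModulus prime
  open OddPrimeModulus {2 ℕ.* q} prime

  K : ℕ
  K = suc k-1 ℕ.* p

  p∣K : p ∣ K
  p∣K = n∣m*n (suc k-1)

  -1-square : IsSquare -1ℤ
  -1-square = ^m≡1⇒square (≡⇒≡-mod (trans (sym (square-^ -1ℤ q)) (ℤₚ.^-zeroˡ q)))

  h≢0 : ¬ h ≡ 0ℤ mod p
  h≢0 h≡0 = ¬prime[1] (subst Prime (h-coprime (p∣K , ≡0-mod⇒∣ h≡0)) prime)

  r : ℕ → ℕ
  r μ = residue (h * + μ) K

  r-≡ : ∀ μ → + r μ ≡ h * + μ mod K
  r-≡ μ = %ℕ-≡-mod (h * + μ)

  r-< : ∀ μ → r μ ℕ.< K
  r-< μ = n%ℕd<d (h * + μ) K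

  r-injective : ∀ {μ ν} → μ ℕ.< K → ν ℕ.< K → h * + μ ≡ h * + ν mod K → μ ≡ ν
  r-injective {μ} {ν} μ<K ν<K hμ≡hν = ≡-mod-canonical μ<K ν<K (*-cancelʳ-coprime h-coprime (begin
    + μ * h   ≡⟨ ℤₚ.*-comm (+ μ) h ⟩
    h * + μ   ≈⟨ hμ≡hν ⟩
    h * + ν   ≡⟨ ℤₚ.*-comm h (+ ν) ⟩
    + ν * h   ∎))
    where open ≡-mod-Reasoning K

  -- K is odd, so exactly one of r μ and K ∸ r μ is even
  gauss-map : ℕ → ℕ
  gauss-map μ with 2 ∣? r μ
  ... | yes _ = r μ
  ... | no  _ = K ℕ.∸ r μ

  sign : ℕ → ℤ
  sign μ with 2 ∣? r μ
  ... | yes _ = 1ℤ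
  ... | no  _ = -1ℤ

  gauss-map-≡ : ∀ μ → + gauss-map μ ≡ sign μ * h * + μ mod p
  gauss-map-≡ μ with 2 ∣? r μ
  ... | yes _ = begin
    + r μ            ≈⟨ ≡-mod-∣ p∣K (r-≡ μ) ⟩
    h * + μ          ≡⟨ ℤₚ.*-identityˡ (h * + μ) ⟨
    1ℤ * (h * + μ)   ≡⟨ ℤₚ.*-assoc 1ℤ h (+ μ) ⟨
    1ℤ * h * + μ     ∎
    where open ≡-mod-Reasoning p
  ... | no  _ = begin
    + (K ℕ.∸ r μ)     ≈⟨ ∸-≡-mod p∣K (ℕₚ.<⇒≤ (r-< μ)) ⟩
    - + r μ           ≈⟨ -‿cong (≡-mod-∣ p∣K (r-≡ μ)) ⟩
    - (h * + μ)       ≡⟨ negate h (+ μ) ⟩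
    -1ℤ * h * + μ     ∎
    where
    open ≡-mod-Reasoning p
    negate : ∀ h μ → - (h * μ) ≡ -1ℤ * h * μ
    negate = solve-∀

  sign-square : ∀ μ → IsSquare (sign μ)
  sign-square μ with 2 ∣? r μ
  ... | yes _ = 1ℤ , ≡-mod-refl
  ... | no  _ = -1-square

  sign≢0 : ∀ μ → ¬ sign μ ≡ 0ℤ mod p
  sign≢0 μ with 2 ∣? r μ
  ... | yes _ = 1≢0
  ... | no  _ = -1≢0

  legendre-gauss-map : ∀ μ → legendre p (gauss-map μ) ≡ legendre p μ
  legendre-gauss-map μ =
    legendre-*-square (*-≢0 (sign≢0 μ) h≢0) (square-* (sign-square μ) h-square) (gauss-map-≡ μ)

  r-positive : ∀ {μ} → 0 ℕ.< μ → μ ℕ.< K → 0 ℕ.< r μ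
  r-positive {μ} 0<μ μ<K = ℕₚ.n≢0⇒n>0 λ r≡0 → ℕₚ.<⇒≢ 0<μ (sym (r-injective μ<K (s≤s z≤n) (begin
    h * + μ   ≈⟨ r-≡ μ ⟨
    + r μ     ≡⟨ cong +_ r≡0 ⟩
    0ℤ        ≡⟨ ℤₚ.*-zeroʳ h ⟨
    h * + 0   ∎)))
    where open ≡-mod-Reasoning K

  gauss-map-bounds : ∀ {μ} → 0 ℕ.< μ → μ ℕ.< K → 0 ℕ.< gauss-map μ × gauss-map μ ℕ.< K
  gauss-map-bounds {μ} 0<μ μ<K with 2 ∣? r μ
  ... | yes _ = r-positive 0<μ μ<K , r-< μ
  ... | no  _ = ℕₚ.m<n⇒0<n∸m (r-< μ) , ℕₚ.∸-monoʳ-< (r-positive 0<μ μ<K) (ℕₚ.<⇒≤ (r-< μ))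

  gauss-map-even : ∀ μ → 2 ∣ gauss-map μ
  gauss-map-even μ with 2 ∣? r μ
  ... | yes 2∣r = 2∣r
  ... | no  2∤r = odd∸odd⇒even K-odd 2∤r (ℕₚ.<⇒≤ (r-< μ))

  h^[kq]≡h^q : h ^ (suc k-1 ℕ.* q) ≡ h ^ q mod p
  h^[kq]≡h^q = begin
    h ^ (suc k-1 ℕ.* q)               ≡⟨ cong (λ k → h ^ (k ℕ.* q)) k≡1+j*2 ⟩
    h ^ ((1 ℕ.+ j ℕ.* 2) ℕ.* q)       ≡⟨ cong (h ^_) (expand j q) ⟩
    h ^ (q ℕ.+ 2 ℕ.* q ℕ.* j)         ≡⟨ ℤₚ.^-distribˡ-+-* h q (2 ℕ.* q ℕ.* j) ⟩
    h ^ q * h ^ (2 ℕ.* q ℕ.* j)       ≡⟨ cong (h ^ q *_) (ℤₚ.^-*-assoc h (2 ℕ.* q) j) ⟨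
    h ^ q * (h ^ (2 ℕ.* q)) ^ j       ≈⟨ *-congˡ (h ^ q) (^-cong j (square⇒^m≡1 h≢0 h-square)) ⟩
    h ^ q * 1ℤ ^ j                    ≡⟨ cong (h ^ q *_) (ℤₚ.^-zeroˡ j) ⟩
    h ^ q * 1ℤ                        ≡⟨ ℤₚ.*-identityʳ (h ^ q) ⟩
    h ^ q                             ∎
    where
    open ≡-mod-Reasoning p
    j : ℕ
    j = suc k-1 ℕ./ 2
    k-odd : ¬ 2 ∣ suc k-1
    k-odd 2∣k = K-odd (∣m⇒∣m*n p 2∣k)
    k≡1+j*2 : suc k-1 ≡ 1 ℕ.+ j ℕ.* 2
    k≡1+j*2 = trans (m≡m%n+[m/n]*n (suc k-1) 2) (cong (ℕ._+ j ℕ.* 2) (odd⇒%2≡1 k-odd))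
    expand : ∀ j q → (1 ℕ.+ j ℕ.* 2) ℕ.* q ≡ q ℕ.+ 2 ℕ.* q ℕ.* j
    expand = ℕ-solve-∀

  odd-image? : Decidable (λ μ → ¬ 2 ∣ r μ)
  odd-image? μ = ¬? (2 ∣? r μ)

  ∏-sign : ∀ xs → ∏ sign xs ≡ -1ℤ ^ count odd-image? xs
  ∏-sign []       = refl
  ∏-sign (x ∷ xs) with 2 ∣? r x
  ... | yes 2∣r = trans (ℤₚ.*-identityˡ (∏ sign xs)) (trans (∏-sign xs)
                    (cong (λ l → -1ℤ ^ length l) (sym (filter-reject odd-image? (λ 2∤r → 2∤r 2∣r)))))
  ... | no  2∤r = trans (cong (-1ℤ *_) (∏-sign xs))
                    (cong (λ l → -1ℤ ^ length l) (sym (filter-accept odd-image? 2∤r)))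

  legendre-K∸ : ∀ {ν} → ν ℕ.≤ K → legendre p (K ℕ.∸ ν) ≡ legendre p ν
  legendre-K∸ {ν} ν≤K = legendre-*-square -1≢0 -1-square
    (≡-mod-trans (∸-≡-mod p∣K ν≤K) (≡⇒≡-mod (sym (ℤₚ.-1*i≡-i (+ ν)))))

  legendre-periodic : ∀ x → legendre p (p ℕ.+ x) ≡ legendre p x
  legendre-periodic x = legendre-*-square 1≢0 (1ℤ , ≡-mod-refl) (begin
    + (p ℕ.+ x)   ≡⟨ ℤₚ.pos-+ p x ⟩
    + p + + x     ≈⟨ +-cong (∣⇒≡0-mod {a = + p} ∣-refl) (≡-mod-refl {a = + x}) ⟩
    0ℤ + + x      ≡⟨ ℤₚ.+-identityˡ (+ x) ⟩
    + x           ≡⟨ ℤₚ.*-identityˡ (+ x) ⟨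
    1ℤ * + x      ∎)
    where open ≡-mod-Reasoning p

  module _ {s : ℤ} (s≢0 : s ≢ 0ℤ) where

    inClass⇒p∤ : ∀ {μ} → legendre p μ ≡ s → ¬ p ∣ μ
    inClass⇒p∤ legendre≡s = legendre≢0⇒∤ (s≢0 ∘ trans (sym legendre≡s))

    EvenInClass : ℕ → Set
    EvenInClass μ = 0 ℕ.< μ × ¬ (p ∣ μ) × (2 ∣ μ) × legendre p μ ≡ s

    evenInClass? : Decidable EvenInClass
    evenInClass? μ = (0 ℕ.<? μ) ×-dec ¬? (p ∣? μ) ×-dec (2 ∣? μ) ×-dec (legendre p μ ℤ.≟ s)

    evens : List ℕ
    evens = filter evenInClass? (upTo K)

    evens! : Unique evens
    evens! = Unique.filter⁺ evenInClass? (Unique.upTo⁺ K)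

    ∈-evens⁻ : ∀ {μ} → μ ∈ evens → μ ℕ.< K × EvenInClass μ
    ∈-evens⁻ μ∈ = Product.map₁ ∈-upTo⁻ (∈-filter⁻ evenInClass? {xs = upTo K} μ∈)

    gauss-map-closed : ∀ {μ} → μ ∈ evens → gauss-map μ ∈ evens
    gauss-map-closed {μ} μ∈ =
      let μ<K , 0<μ , _ , _ , legendre≡s = ∈-evens⁻ μ∈
          0<gμ , gμ<K = gauss-map-bounds 0<μ μ<K
      in ∈-filter⁺ evenInClass? (∈-upTo⁺ gμ<K)
           ( 0<gμ , inClass⇒p∤ (trans (legendre-gauss-map μ) legendre≡s)
           , gauss-map-even μ , trans (legendre-gauss-map μ) legendre≡s)

    r≢K∸r : ∀ {μ ν} → μ ∈ evens → ν ∈ evens → r μ ≢ K ℕ.∸ r ν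
    r≢K∸r {μ} {ν} μ∈ ν∈ rμ≡K-rν =
      let μ<K , _ , _ , 2∣μ , _ = ∈-evens⁻ μ∈
          ν<K , 0<ν , _ , 2∣ν , _ = ∈-evens⁻ ν∈
      in odd∸even⇒odd K-odd 2∣ν (ℕₚ.<⇒≤ ν<K) (subst (2 ∣_) (μ≡K-ν μ<K 0<ν (ℕₚ.<⇒≤ ν<K)) 2∣μ)
      where
      open ≡-mod-Reasoning K
      μ≡K-ν : μ ℕ.< K → 0 ℕ.< ν → ν ℕ.≤ K → μ ≡ K ℕ.∸ ν
      μ≡K-ν μ<K 0<ν ν≤K = r-injective μ<K (ℕₚ.∸-monoʳ-< 0<ν ν≤K) (begin
        h * + μ              ≈⟨ r-≡ μ ⟨
        + r μ                ≡⟨ cong +_ rμ≡K-rν ⟩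
        + (K ℕ.∸ r ν)        ≈⟨ ∸-≡-mod ∣-refl (ℕₚ.<⇒≤ (r-< ν)) ⟩
        - + r ν              ≈⟨ -‿cong (r-≡ ν) ⟩
        - (h * + ν)          ≡⟨ ℤₚ.neg-distribʳ-* h (+ ν) ⟩
        h * - + ν            ≈⟨ *-congˡ h (∸-≡-mod ∣-refl ν≤K) ⟨
        h * + (K ℕ.∸ ν)      ∎)

    r-injectiveOn-evens : InjectiveOn r evens
    r-injectiveOn-evens {μ} {ν} μ∈ ν∈ rμ≡rν = r-injective (proj₁ (∈-evens⁻ μ∈)) (proj₁ (∈-evens⁻ ν∈))
      (≡-mod-trans (≡-mod-sym (r-≡ μ)) (≡-mod-trans (≡⇒≡-mod (cong +_ rμ≡rν)) (r-≡ ν)))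

    gauss-map-injective : InjectiveOn gauss-map evens
    gauss-map-injective {μ} {ν} μ∈ ν∈ gμ≡gν with 2 ∣? r μ | 2 ∣? r ν
    ... | yes _ | yes _ = r-injectiveOn-evens μ∈ ν∈ gμ≡gν
    ... | yes _ | no  _ = contradiction gμ≡gν (r≢K∸r μ∈ ν∈)
    ... | no  _ | yes _ = contradiction (sym gμ≡gν) (r≢K∸r ν∈ μ∈)
    ... | no  _ | no  _ =
      r-injectiveOn-evens μ∈ ν∈ (ℕₚ.∸-cancelˡ-≡ (ℕₚ.<⇒≤ (r-< μ)) (ℕₚ.<⇒≤ (r-< ν)) gμ≡gν)

    gauss-product : -1ℤ ^ count odd-image? evens * h ^ length evens ≡ 1ℤ mod p
    gauss-product = *-cancelʳ (∏-≢0 evens (λ μ∈ → proj₁ (proj₂ (proj₂ (∈-evens⁻ μ∈))) ∘ ≡0-mod⇒∣)) (begin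
      -1ℤ ^ count odd-image? evens * h ^ length evens * ∏ +_ evens
        ≡⟨ cong₂ (λ x y → x * y * ∏ +_ evens) (∏-sign evens) (∏-const h evens) ⟨
      ∏ sign evens * ∏ (λ _ → h) evens * ∏ +_ evens
        ≡⟨ cong (_* ∏ +_ evens) (∏-* sign (λ _ → h) evens) ⟨
      ∏ (λ μ → sign μ * h) evens * ∏ +_ evens
        ≡⟨ ∏-* (λ μ → sign μ * h) +_ evens ⟨
      ∏ (λ μ → sign μ * h * + μ) evens
        ≈⟨ ∏-cong evens (λ {μ} _ → gauss-map-≡ μ) ⟨
      ∏ (+_ ∘ gauss-map) evens
        ≡⟨ ∏-map +_ gauss-map evens ⟨
      ∏ +_ (map gauss-map evens)
        ≡⟨ ∏-↭ +_ (injectiveOn⇒map↭ evens! gauss-map-closed gauss-map-injective) ⟩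
      ∏ +_ evens
        ≡⟨ ℤₚ.*-identityˡ (∏ +_ evens) ⟨
      1ℤ * ∏ +_ evens ∎)
      where open ≡-mod-Reasoning p

    τ≡count-odd-images : count (tauCond? s h p K) (upTo K) ≡ count odd-image? evens
    τ≡count-odd-images = trans (count-≐ (tauCond? s h p K) (evenInClass? ∩? odd-image?) reassociate (upTo K))
                                (sym (count-filter evenInClass? odd-image? (upTo K)))
      where
      reassociate : TauCond s h p K ≐ EvenInClass ∩ (λ μ → ¬ 2 ∣ r μ)
      reassociate = (λ (a , b , c , d , e) → (a , b , c , d) , e)
                  , (λ ((a , b , c , d) , e) → a , b , c , d , e)

    inClass? : Decidable (λ μ → legendre p μ ≡ s)
    inClass? μ = legendre p μ ℤ.≟ s

    OddInClass : ℕ → Set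
    OddInClass μ = ¬ (2 ∣ μ) × legendre p μ ≡ s

    oddInClass? : Decidable OddInClass
    oddInClass? μ = ¬? (2 ∣? μ) ×-dec (legendre p μ ℤ.≟ s)

    odds : List ℕ
    odds = filter oddInClass? (upTo K)

    ∈-odds⁻ : ∀ {μ} → μ ∈ odds → μ ℕ.< K × OddInClass μ
    ∈-odds⁻ μ∈ = Product.map₁ ∈-upTo⁻ (∈-filter⁻ oddInClass? {xs = upTo K} μ∈)

    count-inClass : count inClass? (upTo K) ≡ length evens ℕ.+ length odds
    count-inClass = count-⊎ inClass? evenInClass? oddInClass? even-or-odd
      [ (λ (_ , _ , _ , legendre≡s) → legendre≡s) , proj₂ ]′
      (λ ((_ , _ , 2∣μ , _) , 2∤μ , _) → 2∤μ 2∣μ) (upTo K)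
      where
      even-or-odd : ∀ {μ} → legendre p μ ≡ s → EvenInClass μ ⊎ OddInClass μ
      even-or-odd {μ} legendre≡s =
        Sum.map (λ 2∣μ → 0<μ , p∤μ , 2∣μ , legendre≡s) (_, legendre≡s) (toSum (2 ∣? μ))
        where
        p∤μ : ¬ p ∣ μ
        p∤μ = inClass⇒p∤ legendre≡s
        0<μ : 0 ℕ.< μ
        0<μ = ℕₚ.n≢0⇒n>0 (λ μ≡0 → p∤μ (subst (p ∣_) (sym μ≡0) (p ∣0)))

    even↦odd : ∀ {μ} → μ ∈ evens → K ℕ.∸ μ ∈ odds
    even↦odd μ∈ =
      let μ<K , 0<μ , _ , 2∣μ , legendre≡s = ∈-evens⁻ μ∈
      in ∈-filter⁺ oddInClass? (∈-upTo⁺ (ℕₚ.∸-monoʳ-< 0<μ (ℕₚ.<⇒≤ μ<K)))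
           (odd∸even⇒odd K-odd 2∣μ (ℕₚ.<⇒≤ μ<K) , trans (legendre-K∸ (ℕₚ.<⇒≤ μ<K)) legendre≡s)

    odd↦even : ∀ {μ} → μ ∈ odds → K ℕ.∸ μ ∈ evens
    odd↦even μ∈ =
      let μ<K , 2∤μ , legendre≡s = ∈-odds⁻ μ∈
      in ∈-filter⁺ evenInClass? (∈-upTo⁺ (ℕₚ.∸-monoʳ-< (odd⇒0< 2∤μ) (ℕₚ.<⇒≤ μ<K)))
           ( ℕₚ.m<n⇒0<n∸m μ<K , inClass⇒p∤ (trans (legendre-K∸ (ℕₚ.<⇒≤ μ<K)) legendre≡s)
           , odd∸odd⇒even K-odd 2∤μ (ℕₚ.<⇒≤ μ<K) , trans (legendre-K∸ (ℕₚ.<⇒≤ μ<K)) legendre≡s)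
      where
      odd⇒0< : ∀ {μ} → ¬ 2 ∣ μ → 0 ℕ.< μ
      odd⇒0< 2∤μ = ℕₚ.n≢0⇒n>0 (λ μ≡0 → 2∤μ (subst (2 ∣_) (sym μ≡0) (2 ∣0)))

    length-evens≡length-odds : length evens ≡ length odds
    length-evens≡length-odds = ℕₚ.≤-antisym
      (injectiveOn⇒length≤ evens! even↦odd (K∸-injective (proj₁ ∘ ∈-evens⁻)))
      (injectiveOn⇒length≤ (Unique.filter⁺ oddInClass? (Unique.upTo⁺ K)) odd↦even
                           (K∸-injective (proj₁ ∘ ∈-odds⁻)))
      where
      K∸-injective : ∀ {xs} → (∀ {μ} → μ ∈ xs → μ ℕ.< K) → InjectiveOn (K ℕ.∸_) xs
      K∸-injective <K μ∈ ν∈ = ℕₚ.∸-cancelˡ-≡ (ℕₚ.<⇒≤ (<K μ∈)) (ℕₚ.<⇒≤ (<K ν∈))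

    length-evens : count inClass? (upTo p) ≡ 2 ℕ.* q → length evens ≡ suc k-1 ℕ.* q
    length-evens count≡2q = +-self-injective (begin
      length evens ℕ.+ length evens          ≡⟨ cong (length evens ℕ.+_) length-evens≡length-odds ⟩
      length evens ℕ.+ length odds           ≡⟨ count-inClass ⟨
      count inClass? (upTo K)                ≡⟨ count-upTo-periodic inClass? {p} periodic (suc k-1) ⟩
      suc k-1 ℕ.* count inClass? (upTo p)    ≡⟨ cong (suc k-1 ℕ.*_) count≡2q ⟩
      suc k-1 ℕ.* (2 ℕ.* q)                  ≡⟨ double (suc k-1) q ⟩
      suc k-1 ℕ.* q ℕ.+ suc k-1 ℕ.* q        ∎)
      where
      open ≡-Reasoning
      periodic : (λ x → legendre p (p ℕ.+ x) ≡ s) ≐ (λ x → legendre p x ≡ s)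
      periodic = (λ {x} → trans (sym (legendre-periodic x))) , (λ {x} → trans (legendre-periodic x))
      double : ∀ k q → k ℕ.* (2 ℕ.* q) ≡ k ℕ.* q ℕ.+ k ℕ.* q
      double = ℕ-solve-∀

    τ-sign-identity : count inClass? (upTo p) ≡ 2 ℕ.* q
                    → -1ℤ ^ count (tauCond? s h p K) (upTo K) * h ^ q ≡ 1ℤ mod p
    τ-sign-identity count≡2q = begin
      -1ℤ ^ count (tauCond? s h p K) (upTo K) * h ^ q
        ≡⟨ cong (λ t → -1ℤ ^ t * h ^ q) τ≡count-odd-images ⟩
      -1ℤ ^ count odd-image? evens * h ^ q
        ≈⟨ *-congˡ (-1ℤ ^ count odd-image? evens) h^[kq]≡h^q ⟨
      -1ℤ ^ count odd-image? evens * h ^ (suc k-1 ℕ.* q)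
        ≡⟨ cong (λ e → -1ℤ ^ count odd-image? evens * h ^ e) (length-evens count≡2q) ⟨
      -1ℤ ^ count odd-image? evens * h ^ length evens
        ≈⟨ gauss-product ⟩
      1ℤ ∎
      where open ≡-mod-Reasoning p

  τer-sign-identity : -1ℤ ^ τer h p K * h ^ q ≡ 1ℤ mod p
  τer-sign-identity = τ-sign-identity {1ℤ} (λ ()) count-residues

  τes-sign-identity : -1ℤ ^ τes h p K * h ^ q ≡ 1ℤ mod p
  τes-sign-identity = τ-sign-identity { -1ℤ} (λ ()) count-nonresidues

  τes≡τer-parity : τes h p K ℕ.% 2 ≡ τer h p K ℕ.% 2
  τes≡τer-parity = -1^≡-1^⇒%2≡ 1≢-1 (τes h p K) (τer h p K)
    (*-cancelʳ (^-≢0 q h≢0) (≡-mod-trans τes-sign-identity (≡-mod-sym τer-sign-identity)))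

  τer-parity : ∀ e → h ^ q ≡ -1ℤ ^ e mod p → τer h p K ℕ.% 2 ≡ e ℕ.% 2
  τer-parity e h^q≡-1^e = -1^≡-1^⇒%2≡ 1≢-1 (τer h p K) e (*-cancelʳ (^-≢0 q h≢0) (begin
    -1ℤ ^ τer h p K * h ^ q     ≈⟨ τer-sign-identity ⟩
    1ℤ                          ≡⟨ ℤₚ.^-zeroˡ e ⟨
    1ℤ ^ e                      ≡⟨ *-^ -1ℤ -1ℤ e ⟩
    -1ℤ ^ e * -1ℤ ^ e           ≈⟨ *-congˡ (-1ℤ ^ e) h^q≡-1^e ⟨
    -1ℤ ^ e * h ^ q             ∎))
    where open ≡-mod-Reasoning p

  quartic⇒h^q≡1 : QuarticResidue h p → h ^ q ≡ 1ℤ mod p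
  quartic⇒h^q≡1 (x , p∣x⁴-h) = begin
    h ^ q                  ≈⟨ ^-cong q x⁴≡h ⟨
    (x * x * (x * x)) ^ q  ≡⟨ square-^ (x * x) q ⟩
    (x * x) ^ (2 ℕ.* q)    ≈⟨ square⇒^m≡1 (square-root≢0 h≢0 x⁴≡h) (x , ≡-mod-refl) ⟩
    1ℤ                     ∎
    where
    open ≡-mod-Reasoning p
    regroup : ∀ x → x * x * (x * x) ≡ x * x * x * x
    regroup = solve-∀
    x⁴≡h : x * x * (x * x) ≡ h mod p
    x⁴≡h = ≡-mod-trans (≡⇒≡-mod (regroup x)) (∣ᵤ⇒≡-mod p∣x⁴-h)

  nonquartic⇒h^q≡-1 : ¬ QuarticResidue h p → h ^ q ≡ -1ℤ mod p
  nonquartic⇒h^q≡-1 nonquartic = begin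
    h ^ q                  ≈⟨ ^-cong q x²≡h ⟨
    (x * x) ^ q            ≡⟨ square-^ x q ⟩
    x ^ (2 ℕ.* q)          ≈⟨ nonsquare⇒^m≡-1 x̸□ ⟩
    -1ℤ                    ∎
    where
    open ≡-mod-Reasoning p
    x : ℤ
    x = proj₁ h-square
    x²≡h : x * x ≡ h mod p
    x²≡h = proj₂ h-square
    regroup : ∀ y → y * y * (y * y) ≡ y * y * y * y
    regroup = solve-∀
    x̸□ : ¬ IsSquare x
    x̸□ (y , y²≡x) = nonquartic (y , ≡-mod⇒∣ᵤ (begin
      y * y * y * y          ≡⟨ regroup y ⟨
      y * y * (y * y)        ≈⟨ *-cong y²≡x y²≡x ⟩
      x * x                  ≈⟨ x²≡h ⟩
      h                      ∎))

open import Data.Nat using (_*_; _%_; _≤_)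
open import Data.Nat.DivMod using (m≡m%n+[m/n]*n)
open import Data.Nat.Coprimality as Coprime using (gcd≡1⇒coprime)
open import Data.Nat.Tactic.RingSolver using (solve-∀)
open import Data.Integer.GCD using (gcd)

≡1-mod-4⇒ : ∀ {p} → p % 4 ≡ 1 → ∃ λ q → p ≡ suc (2 * (2 * q))
≡1-mod-4⇒ {p} p%4≡1 = p ℕ./ 4 , trans (m≡m%n+[m/n]*n p 4) (cong₂ ℕ._+_ p%4≡1 (four (p ℕ./ 4)))
  where
  four : ∀ q → q * 4 ≡ 2 * (2 * q)
  four = solve-∀

lemma16p1 : (p k K : ℕ) (h : ℤ) → Prime p → p % 4 ≡ 1 → 1 ≤ k → K ≡ k * p
    → ¬ (2 ∣ K) → gcd h (+ K) ≡ + 1 → QuadraticResidue h p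
    → (QuarticResidue h p → τer h p K % 2 ≡ 0)
    × (¬ QuarticResidue h p → τer h p K % 2 ≡ 1)
    × (τes h p K % 2 ≡ τer h p K % 2)
lemma16p1 p (suc k-1) .(suc k-1 * p) h p-prime p%4≡1 (s≤s z≤n) refl K-odd gcd≡1 h-quadratic
  with q , refl ← ≡1-mod-4⇒ {p} p%4≡1 =
  τer-parity 0 ∘ quartic⇒h^q≡1 , τer-parity 1 ∘ nonquartic⇒h^q≡-1 , τes≡τer-parity
  where
  open Congruence using (∣ᵤ⇒≡-mod)
  open TauParity {q} p-prime k-1 K-odd (Coprime.sym (gcd≡1⇒coprime (ℤₚ.+-injective gcd≡1)))
                                       (Product.map₂ ∣ᵤ⇒≡-mod h-quadratic)
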